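{- Let $M_1,M_2$ be matroids of positive rank on disjoint ground sets $S_1,S_2$, with $S'_1\subseteq S_1$, $S'_2\subseteq S_2$, and let $k$ be an integer with $k\ge r(M_1)+\eta_{M_1}(S'_1)+r(M_2)+\eta_{M_2}(S'_2)$. Let $T_1,T_2$ be sets with $|T_1|=k-r(M_1)-|S'_2|$, $|T_2|=k-r(M_2)-|S'_1|$ such that $T_1,T_2,S_1\cup S_2$ are pairwise disjoint. Suppose neither $M_1$ nor $M_2$ is uniform, $\mathcal{Z}'(M_1)\ne\{S'_1\}$ and $\mathcal{Z}'(M_2)\ne\{S'_2\}$. Then $M=M_k(M_1,S'_1,T_1;M_2,S'_2,T_2)$ is a labelled intertwine of $M_1$ and $M_2$.
   Context: All matroids are finite. A cyclic flat is a flat that is a (possibly empty) union of circuits; for a matroid $N$, $\mathcal{Z}'(N)$ denotes its set of nonempty proper cyclic flats, and $\eta_N(Y)=|Y|-r_N(Y)$ is the nullity. A matroid $M$ is a labelled intertwine of $N_1$ and $N_2$ if $M$ has minors equal to $N_1$ and to $N_2$ (equality, not merely isomorphism), but no proper minor of $M$ has minors equal to both. Construction $M_k(N_1,A_1,U_1;N_2,A_2,U_2)$: let $N_1,N_2$ be matroids of positive rank on disjoint ground sets $R_1,R_2$ with rank functions $\rho_1,\rho_2$; let $A_1\subseteq R_1$, $A_2\subseteq R_2$; let $k$ be an integer with $k\ge r(N_1)+\eta_{N_1}(A_1)+r(N_2)+\eta_{N_2}(A_2)$; and let $U_1,U_2$ be sets with $|U_1|=k-r(N_1)-|A_2|$,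 $|U_2|=k-r(N_2)-|A_1|$, such that $U_1,U_2,R_1\cup R_2$ are pairwise disjoint. Let $E=R_1\cup R_2\cup U_1\cup U_2$. Then $M_k(N_1,A_1,U_1;N_2,A_2,U_2)$ is the (existing and unique) matroid on $E$ whose cyclic flats are exactly: $\emptyset$, of rank $0$; $E$, of rank $k$; the sets $F\cup U_1\cup A_2$ for $F\in\mathcal{Z}'(N_1)$, of rank $\rho_1(F)+|U_1|+|A_2|$; and the sets $F\cup U_2\cup A_1$ for $F\in\mathcal{Z}'(N_2)$, of rank $\rho_2(F)+|U_2|+|A_1|$. -}

module Defs where

open import Data.Bool using (Bool; true; false; _∧_; _∨_; not; if_then_else_)
open import Data.Nat using (ℕ; zero; suc; _+_; _∸_; _≤_; _<_)
open import Data.List using (List; []; _∷_; length)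
open import Data.List.Membership.Propositional using (_∈_)
open import Data.List.Relation.Unary.Unique.Propositional using (Unique)
open import Data.Product using (Σ; ∃; _×_; _,_)
open import Data.Sum using (_⊎_)
open import Relation.Nullary using (¬_; does)
open import Relation.Binary.PropositionalEquality using (_≡_)
open import Relation.Binary.Definitions using (DecidableEquality)
open import Function.Bundles using (_⇔_)

Sub : Set → Set
Sub A = A → Bool

module _ {A : Set} where

  infix 4 _∈ₛ_ _⊆ₛ_ _≐_
  infixr 6 _∪ₛ_
  infixr 7 _∩ₛ_

  _∈ₛ_ : A → Sub A → Set
  x ∈ₛ X = X x ≡ true

  _⊆ₛ_ : Sub A → Sub A → Set
  X ⊆ₛ Y = ∀ x → x ∈ₛ X → x ∈ₛ Y

  _≐_ : Sub A → Sub A → Set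
  X ≐ Y = ∀ x → X x ≡ Y x

  ∅ₛ : Sub A
  ∅ₛ _ = false

  _∪ₛ_ : Sub A → Sub A → Sub A
  (X ∪ₛ Y) x = X x ∨ Y x

  _∩ₛ_ : Sub A → Sub A → Sub A
  (X ∩ₛ Y) x = X x ∧ Y x

  count : Sub A → List A → ℕ
  count X [] = zero
  count X (y ∷ ys) = if X y then suc (count X ys) else count X ys

-- Matroids on a finite ground set (a duplicate-free list), given by
-- their rank function (Whitney's rank axioms).  The rank of an arbitrary
-- subset X is the rank of X ∩ E (rk-ext); the axioms are the usual
-- (R1)-(R3) on subsets of E.

record Matroid (A : Set) : Set where
  field
    ground        : List A
    ground-unique : Unique ground
    rk            : Sub A → ℕ
    rk-ext        : ∀ X Y → (∀ x → x ∈ ground → X x ≡ Y x) → rk X ≡ rk Y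
    rk-card       : ∀ X → rk X ≤ count X ground
    rk-mono       : ∀ X Y → X ⊆ₛ Y → rk X ≤ rk Y
    rk-submod     : ∀ X Y → rk (X ∪ₛ Y) + rk (X ∩ₛ Y) ≤ rk X + rk Y

open Matroid public

module _ {A : Set} (_≟_ : DecidableEquality A) where

  mem : List A → Sub A
  mem [] x = false
  mem (y ∷ ys) x = does (x ≟ y) ∨ mem ys x

  _─ₑ_ : Sub A → A → Sub A
  (X ─ₑ x) y = X y ∧ not (does (y ≟ x))

  _+ₑ_ : Sub A → A → Sub A
  (X +ₑ x) y = X y ∨ does (y ≟ x)

  E : Matroid A → Sub A
  E M = mem (ground M)

  card : Matroid A → Sub A → ℕ
  card M X = count X (ground M)

  r : Matroid A → ℕ
  r M = rk M (E M)

  η : Matroid A → Sub A → ℕ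
  η M Y = card M Y ∸ rk M Y

  Independent : Matroid A → Sub A → Set
  Independent M X = X ⊆ₛ E M × rk M X ≡ card M X

  Circuit : Matroid A → Sub A → Set
  Circuit M C = C ⊆ₛ E M × ¬ Independent M C
              × (∀ Y → Y ⊆ₛ C → (∃ λ x → x ∈ₛ C × Y x ≡ false) → Independent M Y)

  -- cyclic: a (possibly empty) union of circuits
  Cyclic : Matroid A → Sub A → Set
  Cyclic M X = X ⊆ₛ E M × (∀ x → x ∈ₛ X → ∃ λ C → Circuit M C × C ⊆ₛ X × x ∈ₛ C)

  Flat : Matroid A → Sub A → Set
  Flat M F = F ⊆ₛ E M × (∀ x → x ∈ₛ E M → F x ≡ false → ¬ (rk M (F +ₑ x) ≡ rk M F))

  CyclicFlat : Matroid A → Sub A → Set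
  CyclicFlat M Z = Flat M Z × Cyclic M Z

  Z' : Matroid A → Sub A → Set
  Z' M Z = CyclicFlat M Z × (∃ λ x → x ∈ₛ Z) × (∃ λ x → x ∈ₛ E M × Z x ≡ false)

  Z'IsSingleton : Matroid A → Sub A → Set
  Z'IsSingleton M S = Z' M S × (∀ Z → Z' M Z → Z ≐ S)

  Uniform : Matroid A → Set
  Uniform M = ∀ X → X ⊆ₛ E M → card M X ≡ r M → Independent M X

  -- N = M / C \ D for some disjoint C, D ⊆ E(M)  (D = E(M) - C - E(N))
  IsMinor : Matroid A → Matroid A → Set
  IsMinor N M = Σ (Sub A) λ C → C ⊆ₛ E M × E N ⊆ₛ E M
              × (∀ x → x ∈ₛ E N → C x ≡ false)
              × (∀ X → rk N X ≡ rk M ((X ∩ₛ E N) ∪ₛ C) ∸ rk M C)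

  IsProperMinor : Matroid A → Matroid A → Set
  IsProperMinor N M = IsMinor N M × (∃ λ x → x ∈ₛ E M × E N x ≡ false)

  LabelledIntertwine : Matroid A → Matroid A → Matroid A → Set
  LabelledIntertwine M N₁ N₂ =
    IsMinor N₁ M × IsMinor N₂ M
    × (∀ (N : Matroid A) → IsProperMinor N M → ¬ (IsMinor N₁ N × IsMinor N₂ N))

  -- M is M_k(N₁, A₁, U₁; N₂, A₂, U₂): ground set R₁ ∪ R₂ ∪ U₁ ∪ U₂ and
  -- its cyclic flats (with ranks) are exactly the listed ones.
  IsMk : Matroid A → ℕ → Matroid A → Sub A → List A → Matroid A → Sub A → List A → Set
  IsMk M k N₁ A₁ U₁ N₂ A₂ U₂ =
    (E M ≐ E N₁ ∪ₛ E N₂ ∪ₛ mem U₁ ∪ₛ mem U₂)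
    × (∀ Z → CyclicFlat M Z ⇔
         ((Z ≐ ∅ₛ) ⊎ (Z ≐ E M)
          ⊎ (∃ λ F → Z' N₁ F × (Z ≐ F ∪ₛ mem U₁ ∪ₛ A₂))
          ⊎ (∃ λ F → Z' N₂ F × (Z ≐ F ∪ₛ mem U₂ ∪ₛ A₁))))
    × rk M ∅ₛ ≡ 0
    × r M ≡ k
    × (∀ F → Z' N₁ F → rk M (F ∪ₛ mem U₁ ∪ₛ A₂) ≡ rk N₁ F + length U₁ + card N₂ A₂)
    × (∀ F → Z' N₂ F → rk M (F ∪ₛ mem U₂ ∪ₛ A₁) ≡ rk N₂ F + length U₂ + card N₁ A₁)

module Submission where

-- Write P₁ = T₁ ∪ S₂' and P₂ = T₂ ∪ S₁'.  The proof rests on the rank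
-- formula for cyclic flats: every Y ⊆ E(M) lies above a cyclic flat Z with
-- r(Z) + |Y ∖ Z| ≤ r(Y) (obtained from the closure of Y by deleting its
-- coloops).  Comparing the four kinds of cyclic flats of M with this formula
-- shows r_M(X ∪ P₁) = r_{M₁}(X) + |P₁| for X ⊆ E(M₁), so M₁ = M / P₁ on
-- E(M₁), and symmetrically M₂ = M / P₂.  Conversely, if M₁ = M / K on E(M₁)
-- for some K disjoint from E(M₁), then a cyclic flat of M₁ differing from S₁'
-- (it exists since M₁ is not uniform and 𝒵'(M₁) ≠ {S₁'}) rules out every
-- cyclic flat of M below its union with K unless K = P₁.  Finally, a proper
-- minor N = M / C ∖ D having both M₁ and M₂ as minors contracts C ∪ C₁ = P₁
-- and C ∪ C₂ = P₂; an element of E(M) ∖ E(N) then lies in both P₁ and P₂ or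
-- outside E(M), both impossible.

open import Defs
open import Data.Bool using (Bool; true; false; _∧_; _∨_; not)
open import Data.Bool.Properties
  using (∧-identityʳ; ∧-zeroʳ; ∨-identityʳ; ∨-zeroʳ; ∧-conicalˡ; ∧-conicalʳ; ∨-conicalˡ; ∨-conicalʳ; ∧-comm; ∨-comm; ∨-assoc)
open import Data.Nat using (ℕ; suc; _+_; _∸_; _≤_; _<_; z≤n; s≤s; _≟_)
open import Data.Nat.Properties
open import Data.Nat.Tactic.RingSolver using (solve-∀)
open import Data.List using (List; []; _∷_; length)
open import Data.List.Membership.Propositional using (_∈_)
open import Data.List.Relation.Unary.Any using (here; there)
open import Data.List.Relation.Unary.All using (All; _∷_) renaming (lookup to All-lookup)
open import Data.List.Relation.Unary.AllPairs using (_∷_)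
open import Data.List.Relation.Unary.Unique.Propositional using (Unique)
open import Data.Product using (Σ; ∃; _×_; _,_; proj₁; proj₂)
open import Data.Sum using (_⊎_; inj₁; inj₂)
open import Data.Empty using (⊥; ⊥-elim)
open import Relation.Nullary using (¬_; Dec; does; yes; no)
open import Relation.Nullary.Decidable using (dec-true)
open import Relation.Binary.PropositionalEquality
open import Relation.Binary.Definitions using (DecidableEquality)
open import Function.Bundles using (_⇔_; mk⇔; Equivalence)

bool-clash : ∀ {b : Bool} → b ≡ true → b ≡ false → ⊥
bool-clash refl ()

not-true : ∀ {b} → not b ≡ true → b ≡ false
not-true {false} _ = refl

not-false : ∀ {b} → not b ≡ false → b ≡ true
not-false {true} _ = refl

∧-swapʳ : ∀ a b c → (a ∧ b) ∧ c ≡ (a ∧ c) ∧ b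
∧-swapʳ true b c = ∧-comm b c
∧-swapʳ false b c = refl

module _ {A : Set} where

  infixl 7 _∖_

  _∖_ : Sub A → Sub A → Sub A
  (X ∖ Y) x = X x ∧ not (Y x)

  ⊆-false : ∀ {X Y : Sub A} x → X ⊆ₛ Y → Y x ≡ false → X x ≡ false
  ⊆-false {X} x X⊆Y Yx with X x in e
  ... | true = ⊥-elim (bool-clash (X⊆Y x e) Yx)
  ... | false = refl

  disjoint-sym : ∀ {X Y : Sub A} → (∀ x → X x ≡ true → Y x ≡ false) → ∀ x → Y x ≡ true → X x ≡ false
  disjoint-sym {X} disj x Yx with X x in Xx
  ... | true = ⊥-elim (bool-clash Yx (disj x Xx))
  ... | false = refl

  ∪-elim : ∀ (X {Y} : Sub A) {x} → x ∈ₛ (X ∪ₛ Y) → x ∈ₛ X ⊎ x ∈ₛ Y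
  ∪-elim X {x = x} p with X x
  ... | true = inj₁ refl
  ... | false = inj₂ p

  ∪-⊆ : ∀ {X Y Z : Sub A} → X ⊆ₛ Z → Y ⊆ₛ Z → (X ∪ₛ Y) ⊆ₛ Z
  ∪-⊆ {X} {Y} X⊆Z Y⊆Z x p with ∪-elim X {Y} p
  ... | inj₁ q = X⊆Z x q
  ... | inj₂ q = Y⊆Z x q

  ⊆-∪ˡ : ∀ (X Y : Sub A) → X ⊆ₛ (X ∪ₛ Y)
  ⊆-∪ˡ X Y x p rewrite p = refl

  ⊆-∪ʳ : ∀ (X Y : Sub A) → Y ⊆ₛ (X ∪ₛ Y)
  ⊆-∪ʳ X Y x p rewrite p = ∨-zeroʳ (X x)

  ∈-∖ : ∀ (X Y : Sub A) {x} → X x ≡ true → Y x ≡ false → (X ∖ Y) x ≡ true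
  ∈-∖ X Y Xx Yx rewrite Xx | Yx = refl

  ∉-∪ : ∀ (X Y : Sub A) {x} → X x ≡ false → Y x ≡ false → (X ∪ₛ Y) x ≡ false
  ∉-∪ X Y Xx Yx rewrite Xx | Yx = refl

  ∖-empty : ∀ (X : Sub A) {Y} → Y ≐ ∅ₛ → (X ∖ Y) ≐ X
  ∖-empty X Y≐∅ x rewrite Y≐∅ x = ∧-identityʳ (X x)

  ∖-congʳ : ∀ (X : Sub A) {Y Y'} → Y ≐ Y' → (X ∖ Y) ≐ (X ∖ Y')
  ∖-congʳ X Y≐Y' x = cong (λ b → X x ∧ not b) (Y≐Y' x)

  ∖-self : ∀ (X : Sub A) → (X ∖ X) ≐ ∅ₛ
  ∖-self X x with X x
  ... | true = refl
  ... | false = refl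

  ∪∖-cancel : ∀ (X Y : Sub A) → ((X ∪ₛ Y) ∖ Y) ≐ (X ∖ Y)
  ∪∖-cancel X Y x with Y x
  ... | true = trans (∧-zeroʳ _) (sym (∧-zeroʳ (X x)))
  ... | false = cong (_∧ true) (∨-identityʳ (X x))

  ∩-absorb : ∀ {X Y : Sub A} → X ⊆ₛ Y → (X ∩ₛ Y) ≐ X
  ∩-absorb {X} X⊆Y x with X x in Xx
  ... | true = X⊆Y x Xx
  ... | false = refl

  ∪-absorb : ∀ {X Y : Sub A} → X ⊆ₛ Y → (X ∪ₛ Y) ≐ Y
  ∪-absorb {X} X⊆Y z with X z in Xz
  ... | true = sym (X⊆Y z Xz)
  ... | false = refl

  ∖-⊆ : ∀ (X Y : Sub A) → (X ∖ Y) ⊆ₛ X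
  ∖-⊆ X Y x p = ∧-conicalˡ (X x) _ p

  ∖-monoˡ : ∀ {X Y : Sub A} (Z : Sub A) → X ⊆ₛ Y → (X ∖ Z) ⊆ₛ (Y ∖ Z)
  ∖-monoˡ {X} {Y} Z X⊆Y x p rewrite X⊆Y x (∧-conicalˡ (X x) _ p) = ∧-conicalʳ (X x) _ p

  ∪∖∪-⊆ : ∀ (X Y Z : Sub A) → ((X ∪ₛ Y) ∖ (Z ∪ₛ Y)) ⊆ₛ (X ∖ Z)
  ∪∖∪-⊆ X Y Z x = pointwise (X x) (Y x) (Z x)
    where
    pointwise : ∀ x y z → (x ∨ y) ∧ not (z ∨ y) ≡ true → x ∧ not z ≡ true
    pointwise true false false _ = refl
    pointwise true true true ()
    pointwise true true false ()
    pointwise true false true ()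
    pointwise false true true ()
    pointwise false true false ()
    pointwise false false true ()
    pointwise false false false ()

  ∖-⊆-∪∖∪ : ∀ {X Y : Sub A} (Z : Sub A) → (∀ x → X x ≡ true → Y x ≡ false)
            → (X ∖ Z) ⊆ₛ ((X ∪ₛ Y) ∖ (Z ∪ₛ Y))
  ∖-⊆-∪∖∪ {X} {Y} Z disj x p
    rewrite ∧-conicalˡ (X x) _ p | disj x (∧-conicalˡ (X x) _ p) | ∨-identityʳ (Z x) = ∧-conicalʳ (X x) _ p

  ⊆-antisym : ∀ {X Y : Sub A} → X ⊆ₛ Y → Y ⊆ₛ X → X ≐ Y
  ⊆-antisym {X} {Y} X⊆Y Y⊆X x with X x in ex | Y x in ey
  ... | true | true = refl
  ... | true | false = ⊥-elim (bool-clash (X⊆Y x ex) ey)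
  ... | false | true = ⊥-elim (bool-clash (Y⊆X x ey) ex)
  ... | false | false = refl

  count-∷-∈ : ∀ {X : Sub A} {y} l → X y ≡ true → count X (y ∷ l) ≡ suc (count X l)
  count-∷-∈ l Xy rewrite Xy = refl

  count-∷-∉ : ∀ {X : Sub A} {y} l → X y ≡ false → count X (y ∷ l) ≡ count X l
  count-∷-∉ l Xy rewrite Xy = refl

  count-ext : ∀ {X Y : Sub A} l → (∀ x → x ∈ l → X x ≡ Y x) → count X l ≡ count Y l
  count-ext [] h = refl
  count-ext {X} {Y} (y ∷ l) h rewrite h y (here refl) | count-ext {X} {Y} l (λ x p → h x (there p)) = refl

  count-≐ : ∀ {X Y : Sub A} l → X ≐ Y → count X l ≡ count Y l
  count-≐ l X≐Y = count-ext l (λ x _ → X≐Y x)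

  count-mono : ∀ {X Y : Sub A} l → X ⊆ₛ Y → count X l ≤ count Y l
  count-mono [] h = z≤n
  count-mono {X} {Y} (y ∷ l) h with X y in ex | Y y in ey
  ... | true | true = s≤s (count-mono l h)
  ... | true | false = ⊥-elim (bool-clash (h y ex) ey)
  ... | false | true = m≤n⇒m≤1+n (count-mono l h)
  ... | false | false = count-mono l h

  count-∅ : ∀ l → count (∅ₛ {A}) l ≡ 0
  count-∅ [] = refl
  count-∅ (y ∷ l) = count-∅ l

  count-split : ∀ (X Y : Sub A) l → count X l ≡ count (X ∩ₛ Y) l + count (X ∖ Y) l
  count-split X Y [] = refl
  count-split X Y (y ∷ l) with X y | Y y
  ... | true | true = cong suc (count-split X Y l)
  ... | true | false = trans (cong suc (count-split X Y l)) (sym (+-suc _ _))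
  ... | false | true = count-split X Y l
  ... | false | false = count-split X Y l

  count-union : ∀ (X Y : Sub A) l → (∀ x → X x ≡ true → Y x ≡ false)
              → count (X ∪ₛ Y) l ≡ count X l + count Y l
  count-union X Y [] disj = refl
  count-union X Y (y ∷ l) disj with X y in ex | Y y in ey
  ... | true | true = ⊥-elim (bool-clash ey (disj y ex))
  ... | true | false = cong suc (count-union X Y l disj)
  ... | false | true = trans (cong suc (count-union X Y l disj)) (sym (+-suc _ _))
  ... | false | false = count-union X Y l disj

  search : (Z : Sub A) → ∀ l → (∃ λ x → x ∈ l × Z x ≡ true) ⊎ (∀ x → x ∈ l → Z x ≡ false)
  search Z [] = inj₂ (λ x ())
  search Z (y ∷ l) with Z y in e
  ... | true = inj₁ (y , here refl , e)
  ... | false with search Z l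
  ...   | inj₁ (x , x∈l , p) = inj₁ (x , there x∈l , p)
  ...   | inj₂ h = inj₂ λ { x (here refl) → e ; x (there x∈l) → h x x∈l }

module _ {A : Set} (eq : DecidableEquality A) where

  private
    _⊖_ : Sub A → A → Sub A
    _⊖_ = _─ₑ_ eq
    _⊕_ : Sub A → A → Sub A
    _⊕_ = _+ₑ_ eq

  mem-∈ : ∀ l {x} → mem eq l x ≡ true → x ∈ l
  mem-∈ [] ()
  mem-∈ (y ∷ l) {x} h with eq x y
  ... | yes p = here p
  ... | no _ = there (mem-∈ l h)

  ∈-mem : ∀ {l x} → x ∈ l → mem eq l x ≡ true
  ∈-mem {y ∷ l} {x} (here p) with eq x y
  ... | yes _ = refl
  ... | no x≢y = ⊥-elim (x≢y p)
  ∈-mem {y ∷ l} {x} (there p) with eq x y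
  ... | yes _ = refl
  ... | no _ = ∈-mem p

  ∉-mem : ∀ {l x} → All (λ y → x ≢ y) l → mem eq l x ≡ false
  ∉-mem {[]} _ = refl
  ∉-mem {y ∷ l} {x} (x≢y ∷ x∉l) with eq x y
  ... | yes x≡y = ⊥-elim (x≢y x≡y)
  ... | no _ = ∉-mem x∉l

  mem-∷-other : ∀ {l z y} → z ≢ y → mem eq (y ∷ l) z ≡ mem eq l z
  mem-∷-other {l} {z} {y} z≢y with eq z y
  ... | yes z≡y = ⊥-elim (z≢y z≡y)
  ... | no _ = refl

  ⊖-same : ∀ (X : Sub A) x → (X ⊖ x) x ≡ false
  ⊖-same X x with eq x x
  ... | yes _ = ∧-zeroʳ (X x)
  ... | no x≢x = ⊥-elim (x≢x refl)

  ⊖-other : ∀ (X : Sub A) {x y} → y ≢ x → (X ⊖ x) y ≡ X y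
  ⊖-other X {x} {y} y≢x with eq y x
  ... | yes p = ⊥-elim (y≢x p)
  ... | no _ = ∧-identityʳ (X y)

  ⊖-⊆ : ∀ (X : Sub A) x → (X ⊖ x) ⊆ₛ X
  ⊖-⊆ X x y p = ∖-⊆ X (λ z → does (eq z x)) y p

  ⊖-≢ : ∀ (X : Sub A) {x y} → (X ⊖ x) y ≡ true → y ≢ x
  ⊖-≢ X {x} {y} p refl = bool-clash p (⊖-same X y)

  ⊕-same : ∀ (X : Sub A) x → (X ⊕ x) x ≡ true
  ⊕-same X x with eq x x
  ... | yes _ = ∨-zeroʳ (X x)
  ... | no x≢x = ⊥-elim (x≢x refl)

  ⊆-⊕ : ∀ (X : Sub A) x → X ⊆ₛ (X ⊕ x)
  ⊆-⊕ X x y p rewrite p = refl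

  ⊕-mono : ∀ {X Y : Sub A} x → X ⊆ₛ Y → (X ⊕ x) ⊆ₛ (Y ⊕ x)
  ⊕-mono {X} {Y} x X⊆Y y p with eq y x
  ... | yes refl = ∨-zeroʳ (Y y)
  ... | no _ = trans (∨-identityʳ (Y y)) (X⊆Y y (trans (sym (∨-identityʳ (X y))) p))

  ⊕-absorb : ∀ (X : Sub A) {x} → X x ≡ true → (X ⊕ x) ≐ X
  ⊕-absorb X {x} Xx y with eq y x
  ... | yes refl rewrite Xx = refl
  ... | no _ = ∨-identityʳ (X y)

  ⊕-⊆ : ∀ {X Y : Sub A} {x} → X ⊆ₛ Y → Y x ≡ true → (X ⊕ x) ⊆ₛ Y
  ⊕-⊆ {X} {Y} {x} X⊆Y Yx y p with eq y x
  ... | yes refl = Yx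
  ... | no _ = X⊆Y y (trans (sym (∨-identityʳ (X y))) p)

  ⊕⊖-cancel : ∀ (X : Sub A) {x} → X x ≡ false → ((X ⊕ x) ⊖ x) ≐ X
  ⊕⊖-cancel X {x} Xx y with eq y x
  ... | yes refl rewrite ∨-zeroʳ (X y) = sym Xx
  ... | no _ rewrite ∨-identityʳ (X y) = ∧-identityʳ (X y)

  ⊖⊕-comm : ∀ (X : Sub A) {x z} → z ≢ x → ((X ⊖ z) ⊕ x) ≐ ((X ⊕ x) ⊖ z)
  ⊖⊕-comm X {x} {z} z≢x y with eq y z | eq y x
  ... | yes refl | yes refl = ⊥-elim (z≢x refl)
  ... | yes refl | no _ rewrite ∧-zeroʳ (X y) | ∨-identityʳ (X y) = sym (∧-zeroʳ (X y))
  ... | no _ | yes refl rewrite ∨-zeroʳ (X y ∧ true) | ∨-zeroʳ (X y) = refl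
  ... | no _ | no _ rewrite ∧-identityʳ (X y) | ∨-identityʳ (X y) = sym (∧-identityʳ (X y))

  ⊖⊕-restore : ∀ (X : Sub A) {x} → X x ≡ true → ((X ⊖ x) ⊕ x) ≐ X
  ⊖⊕-restore X {x} Xx y with eq y x
  ... | yes refl rewrite ∨-zeroʳ (X y ∧ false) = sym Xx
  ... | no _ rewrite ∧-identityʳ (X y) = ∨-identityʳ (X y)

  private
    count-∷-suc : ∀ {X Y : Sub A} {y} l → X y ≡ Y y → count X l ≡ suc (count Y l)
                → count X (y ∷ l) ≡ suc (count Y (y ∷ l))
    count-∷-suc {X} {Y} {y} l Xy≡Yy h rewrite Xy≡Yy with Y y
    ... | true = cong suc h
    ... | false = h

    ∉-head : ∀ {w : A} {ws} → All (λ v → w ≢ v) ws → ∀ {z} → z ∈ ws → z ≢ w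
    ∉-head w∉ z∈ z≡w = All-lookup w∉ z∈ (sym z≡w)

  count-remove : ∀ (X : Sub A) l {x} → Unique l → x ∈ l → X x ≡ true
               → count X l ≡ suc (count (X ⊖ x) l)
  count-remove X (y ∷ l) (y∉l ∷ u) (here refl) Xy = begin
      count X (y ∷ l)             ≡⟨ count-∷-∈ l Xy ⟩
      suc (count X l)             ≡⟨ cong suc (count-ext l (λ z z∈l → sym (⊖-other X (∉-head y∉l z∈l)))) ⟩
      suc (count (X ⊖ y) l)       ≡⟨ cong suc (sym (count-∷-∉ l (⊖-same X y))) ⟩
      suc (count (X ⊖ y) (y ∷ l)) ∎
    where open ≡-Reasoning
  count-remove X (y ∷ l) {x} (y∉l ∷ u) (there x∈l) Xx =
    count-∷-suc l (sym (⊖-other X (All-lookup y∉l x∈l))) (count-remove X l u x∈l Xx)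

  count-list : ∀ T G → Unique T → Unique G → (∀ t → t ∈ T → t ∈ G)
             → count (mem eq T) G ≡ length T
  count-list [] G _ _ _ = count-∅ G
  count-list (t ∷ T) G (t∉T ∷ uT) uG T⊆G =
    trans (count-remove (mem eq (t ∷ T)) G uG (T⊆G t (here refl)) (∈-mem {t ∷ T} (here refl)))
          (cong suc (trans (count-≐ G removed) (count-list T G uT uG (λ z z∈T → T⊆G z (there z∈T)))))
    where
    removed : (mem eq (t ∷ T) ⊖ t) ≐ mem eq T
    removed z with eq z t
    ... | yes refl = sym (∉-mem t∉T)
    ... | no _ = ∧-identityʳ _

  count-sublist : ∀ (X : Sub A) G G' → Unique G → Unique G' → X ⊆ₛ mem eq G
                → (∀ x → x ∈ G → x ∈ G') → count X G' ≡ count X G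
  count-sublist X [] G' _ _ X⊆G _ = trans (count-ext G' (λ z _ → ⊆-false z X⊆G refl)) (count-∅ G')
  count-sublist X (g ∷ G) G' (g∉G ∷ uG) uG' X⊆gG G⊆G' with X g in Xg
  ... | true = begin
      count X G'             ≡⟨ count-remove X G' uG' (G⊆G' g (here refl)) Xg ⟩
      suc (count (X ⊖ g) G') ≡⟨ cong suc (count-sublist (X ⊖ g) G G' uG uG' X⊖g⊆G (λ x x∈G → G⊆G' x (there x∈G))) ⟩
      suc (count (X ⊖ g) G)  ≡⟨ cong suc (count-ext G (λ z z∈G → ⊖-other X (∉-head g∉G z∈G))) ⟩
      suc (count X G)        ∎
    where
    open ≡-Reasoning
    X⊖g⊆G : (X ⊖ g) ⊆ₛ mem eq G
    X⊖g⊆G z p = trans (sym (mem-∷-other {G} (⊖-≢ X p))) (X⊆gG z (⊖-⊆ X g z p))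
  ... | false = count-sublist X G G' uG uG' X⊆G (λ x x∈G → G⊆G' x (there x∈G))
    where
    X⊆G : X ⊆ₛ mem eq G
    X⊆G z p = trans (sym (mem-∷-other {G} z≢g)) (X⊆gG z p)
      where z≢g : z ≢ g
            z≢g refl = bool-clash p Xg

module RankCalculus {A : Set} (eq : DecidableEquality A) (M : Matroid A) where

  infixl 6 _⊕_ _⊖_

  _⊕_ : Sub A → A → Sub A
  _⊕_ = _+ₑ_ eq

  _⊖_ : Sub A → A → Sub A
  _⊖_ = _─ₑ_ eq

  ρ : Sub A → ℕ
  ρ = rk M

  size : Sub A → ℕ
  size X = count X (ground M)

  EM : Sub A
  EM = E eq M

  ρ-≐ : ∀ {X Y} → X ≐ Y → ρ X ≡ ρ Y
  ρ-≐ {X} {Y} X≐Y = rk-ext M X Y (λ x _ → X≐Y x)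

  ρ-mono : ∀ {X Y} → X ⊆ₛ Y → ρ X ≤ ρ Y
  ρ-mono {X} {Y} = rk-mono M X Y

  ρ-size : ∀ X → ρ X ≤ size X
  ρ-size = rk-card M

  ρ-∅ : ρ ∅ₛ ≡ 0
  ρ-∅ = n≤0⇒n≡0 (≤-trans (rk-card M ∅ₛ) (≤-reflexive (count-∅ (ground M))))

  ρ-excess : ∀ Y Z → ρ Y ≤ ρ Z + size (Y ∖ Z)
  ρ-excess Y Z = begin
      ρ Y                                   ≤⟨ ρ-mono Y⊆Z∪Y∖Z ⟩
      ρ (Z ∪ₛ (Y ∖ Z))                      ≤⟨ m≤m+n _ _ ⟩
      ρ (Z ∪ₛ (Y ∖ Z)) + ρ (Z ∩ₛ (Y ∖ Z))   ≤⟨ rk-submod M Z (Y ∖ Z) ⟩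
      ρ Z + ρ (Y ∖ Z)                       ≤⟨ +-monoʳ-≤ (ρ Z) (ρ-size (Y ∖ Z)) ⟩
      ρ Z + size (Y ∖ Z)                    ∎
    where
    open ≤-Reasoning
    Y⊆Z∪Y∖Z : Y ⊆ₛ (Z ∪ₛ (Y ∖ Z))
    Y⊆Z∪Y∖Z x p with Z x
    ... | true = refl
    ... | false rewrite p = refl

  -- submodularity for S ⊆ T and x ∉ T: adding x to the larger set gains
  -- no more than adding it to the smaller one
  diminishing-returns : ∀ {S T x} → S ⊆ₛ T → T x ≡ false → ρ (T ⊕ x) + ρ S ≤ ρ (S ⊕ x) + ρ T
  diminishing-returns {S} {T} {x} S⊆T Tx =
    subst₂ (λ a b → a + b ≤ ρ (S ⊕ x) + ρ T) (ρ-≐ union) (ρ-≐ meet) (rk-submod M (S ⊕ x) T)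
    where
    union : ((S ⊕ x) ∪ₛ T) ≐ (T ⊕ x)
    union y with eq y x
    ... | yes refl rewrite ∨-zeroʳ (S y) | ∨-zeroʳ (T y) = refl
    ... | no _ with S y in Sy | T y in Ty
    ...   | true | true = refl
    ...   | true | false = ⊥-elim (bool-clash (S⊆T y Sy) Ty)
    ...   | false | true = refl
    ...   | false | false = refl
    meet : ((S ⊕ x) ∩ₛ T) ≐ S
    meet y with eq y x
    ... | yes refl rewrite ∨-zeroʳ (S y) | Tx = sym (⊆-false y S⊆T Tx)
    ... | no _ with S y in Sy | T y in Ty
    ...   | true | true = refl
    ...   | true | false = ⊥-elim (bool-clash (S⊆T y Sy) Ty)
    ...   | false | true = refl
    ...   | false | false = refl

  closure-mono : ∀ {S T x} → S ⊆ₛ T → ρ (S ⊕ x) ≡ ρ S → ρ (T ⊕ x) ≡ ρ T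
  closure-mono {S} {T} {x} S⊆T spans with T x in Tx
  ... | true = ρ-≐ (⊕-absorb eq T Tx)
  ... | false = ≤-antisym
      (+-cancelʳ-≤ (ρ S) _ _ (begin
        ρ (T ⊕ x) + ρ S ≤⟨ diminishing-returns S⊆T Tx ⟩
        ρ (S ⊕ x) + ρ T ≡⟨ cong (_+ ρ T) spans ⟩
        ρ S + ρ T       ≡⟨ +-comm (ρ S) (ρ T) ⟩
        ρ T + ρ S       ∎))
      (ρ-mono (⊆-⊕ eq T x))
    where open ≤-Reasoning

  closure-union : ∀ B S → (∀ x → S x ≡ true → ρ (B ⊕ x) ≡ ρ B) → ρ (B ∪ₛ S) ≡ ρ B
  closure-union B S spans = trans (rk-ext M _ _ on-ground) (along (ground M))
    where
    on-ground : ∀ x → x ∈ ground M → (B ∪ₛ S) x ≡ (B ∪ₛ (S ∩ₛ mem eq (ground M))) x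
    on-ground x x∈ rewrite ∈-mem eq {ground M} x∈ | ∧-identityʳ (S x) = refl
    along : ∀ l → ρ (B ∪ₛ (S ∩ₛ mem eq l)) ≡ ρ B
    along [] = ρ-≐ (λ z → trans (cong (B z ∨_) (∧-zeroʳ (S z))) (∨-identityʳ (B z)))
    along (y ∷ l) with S y in Sy
    ... | false = trans (ρ-≐ unchanged) (along l)
      where
      unchanged : (B ∪ₛ (S ∩ₛ mem eq (y ∷ l))) ≐ (B ∪ₛ (S ∩ₛ mem eq l))
      unchanged z with eq z y
      ... | yes refl rewrite Sy = refl
      ... | no _ = refl
    ... | true = trans (ρ-≐ grown) (trans (closure-mono B⊆T (spans y Sy)) (along l))
      where
      T : Sub A
      T = B ∪ₛ (S ∩ₛ mem eq l)
      B⊆T : B ⊆ₛ T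
      B⊆T = ⊆-∪ˡ B (S ∩ₛ mem eq l)
      grown : (B ∪ₛ (S ∩ₛ mem eq (y ∷ l))) ≐ (T ⊕ y)
      grown z with eq z y
      ... | yes refl rewrite Sy with B z
      ...   | true = refl
      ...   | false = sym (∨-zeroʳ (mem eq l z))
      grown z | no _ rewrite ∨-identityʳ (B z ∨ (S z ∧ mem eq l z)) = refl

  coloop-inherited : ∀ {B Y y} → Y ⊆ₛ B → B y ≡ true → Y y ≡ false
                   → suc (ρ (B ⊖ y)) ≤ ρ B → suc (ρ Y) ≤ ρ (Y ⊕ y)
  coloop-inherited {B} {Y} {y} Y⊆B By Yy coloop = +-cancelʳ-≤ (ρ (B ⊖ y)) _ _ (begin
      suc (ρ Y) + ρ (B ⊖ y)      ≡⟨ cong suc (+-comm (ρ Y) _) ⟩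
      suc (ρ (B ⊖ y)) + ρ Y      ≤⟨ +-monoˡ-≤ (ρ Y) coloop ⟩
      ρ B + ρ Y                  ≡⟨ cong (_+ ρ Y) (sym (ρ-≐ (⊖⊕-restore eq B By))) ⟩
      ρ ((B ⊖ y) ⊕ y) + ρ Y      ≤⟨ diminishing-returns Y⊆B⊖y (⊖-same eq B y) ⟩
      ρ (Y ⊕ y) + ρ (B ⊖ y)      ∎)
    where
    open ≤-Reasoning
    Y⊆B⊖y : Y ⊆ₛ (B ⊖ y)
    Y⊆B⊖y z p = trans (⊖-other eq B (λ { refl → bool-clash p Yy })) (Y⊆B z p)

  coloop-step : ∀ {B S y} → S ⊆ₛ B → S y ≡ true → suc (ρ (B ⊖ y)) ≤ ρ B
              → suc (ρ (B ∖ S)) ≤ ρ (B ∖ (S ⊖ y))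
  coloop-step {B} {S} {y} S⊆B Sy coloop =
    subst (suc (ρ (B ∖ S)) ≤_) (ρ-≐ put-back) (coloop-inherited (∖-⊆ B S) (S⊆B y Sy) B∖S-y coloop)
    where
    B∖S-y : (B ∖ S) y ≡ false
    B∖S-y rewrite Sy = ∧-zeroʳ (B y)
    put-back : ((B ∖ S) ⊕ y) ≐ (B ∖ (S ⊖ y))
    put-back z with eq z y
    ... | yes refl rewrite ∧-zeroʳ (S z) | ∧-identityʳ (B z) | S⊆B z Sy = ∨-zeroʳ _
    ... | no _ rewrite ∧-identityʳ (S z) = ∨-identityʳ _

  coloops-bound : ∀ B S → B ⊆ₛ EM → S ⊆ₛ B → (∀ x → S x ≡ true → suc (ρ (B ⊖ x)) ≤ ρ B)
                → ρ (B ∖ S) + size S ≤ ρ B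
  coloops-bound B S B⊆E S⊆B coloop = along (ground M) (ground-unique M) S S⊆B coloop (λ x p → B⊆E x (S⊆B x p))
    where
    along : ∀ l → Unique l → ∀ S → S ⊆ₛ B → (∀ x → S x ≡ true → suc (ρ (B ⊖ x)) ≤ ρ B)
          → S ⊆ₛ mem eq l → ρ (B ∖ S) + count S l ≤ ρ B
    along [] _ S _ _ S⊆[] = ≤-reflexive (trans (+-identityʳ _) (ρ-≐ (∖-empty B S≐∅)))
      where S≐∅ : S ≐ ∅ₛ
            S≐∅ z = ⊆-false z S⊆[] refl
    along (y ∷ l) (y∉l ∷ u) S S⊆B coloop S⊆yl with S y in Sy
    ... | false = along l u S S⊆B coloop S⊆l
      where S⊆l : S ⊆ₛ mem eq l
            S⊆l z p = trans (sym (mem-∷-other eq {l} (λ { refl → bool-clash p Sy }))) (S⊆yl z p)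
    ... | true = begin
        ρ (B ∖ S) + suc (count S l)     ≡⟨ +-suc _ _ ⟩
        suc (ρ (B ∖ S) + count S l)     ≡⟨ cong (λ n → suc (ρ (B ∖ S) + n)) same-count ⟩
        suc (ρ (B ∖ S)) + count S' l    ≤⟨ +-monoˡ-≤ (count S' l) (coloop-step S⊆B Sy (coloop y Sy)) ⟩
        ρ (B ∖ S') + count S' l         ≤⟨ along l u S' (λ z p → S⊆B z (⊖-⊆ eq S y z p))
                                              (λ z p → coloop z (⊖-⊆ eq S y z p)) S'⊆l ⟩
        ρ B                             ∎
      where
      open ≤-Reasoning
      S' : Sub A
      S' = S ⊖ y
      S'⊆l : S' ⊆ₛ mem eq l
      S'⊆l z p = trans (sym (mem-∷-other eq {l} (⊖-≢ eq S p))) (S⊆yl z (⊖-⊆ eq S y z p))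
      same-count : count S l ≡ count S' l
      same-count = count-ext l (λ z z∈l → sym (⊖-other eq S (λ { refl → All-lookup y∉l z∈l refl })))

  independent-≐ : ∀ {X Y} → X ≐ Y → Independent eq M X → Independent eq M Y
  independent-≐ {X} {Y} X≐Y (X⊆E , ρX) =
    (λ z p → X⊆E z (trans (X≐Y z) p)) , trans (sym (ρ-≐ X≐Y)) (trans ρX (count-≐ (ground M) X≐Y))

  independent-⊆ : ∀ {I Y} → Independent eq M I → Y ⊆ₛ I → Independent eq M Y
  independent-⊆ {I} {Y} (I⊆E , ρI) Y⊆I = (λ z p → I⊆E z (Y⊆I z p)) , ≤-antisym (ρ-size Y) lower
    where
    I∩Y : (I ∩ₛ Y) ≐ Y
    I∩Y z with Y z in Yz
    ... | true rewrite Y⊆I z Yz = refl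
    ... | false = ∧-zeroʳ (I z)
    lower : size Y ≤ ρ Y
    lower = +-cancelʳ-≤ (size (I ∖ Y)) _ _ (begin
        size Y + size (I ∖ Y)          ≡⟨ cong (_+ size (I ∖ Y)) (sym (count-≐ (ground M) I∩Y)) ⟩
        size (I ∩ₛ Y) + size (I ∖ Y)   ≡⟨ sym (count-split I Y (ground M)) ⟩
        size I                         ≡⟨ sym ρI ⟩
        ρ I                            ≤⟨ ρ-excess I Y ⟩
        ρ Y + size (I ∖ Y)             ∎)
      where open ≤-Reasoning

  size-⊕ : ∀ X {y} → y ∈ ground M → X y ≡ false → size (X ⊕ y) ≡ suc (size X)
  size-⊕ X {y} y∈ Xy = trans (count-remove eq (X ⊕ y) (ground M) (ground-unique M) y∈ (⊕-same eq X y))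
                             (cong suc (count-≐ (ground M) (⊕⊖-cancel eq X Xy)))

  SpansMinimally : Sub A → A → Set
  SpansMinimally F x = ρ (F ⊕ x) ≡ ρ F × (∀ y → F y ≡ true → ρ ((F ⊖ y) ⊕ x) ≢ ρ (F ⊖ y))

  -- every element of a minimal spanning set is a coloop of it, so the set is independent
  minimal-span-independent : ∀ {F x} → F ⊆ₛ EM → SpansMinimally F x → Independent eq M F
  minimal-span-independent {F} {x} F⊆E (spans , minimal) =
    F⊆E , ≤-antisym (ρ-size F) (m+n≤o⇒n≤o (ρ (F ∖ F)) (coloops-bound F F F⊆E (λ _ p → p) coloop))
    where
    coloop : ∀ y → F y ≡ true → suc (ρ (F ⊖ y)) ≤ ρ F
    coloop y Fy = ≤∧≢⇒< (ρ-mono (⊖-⊆ eq F y)) λ same → minimal y Fy (≤-antisym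
      (≤-trans (ρ-mono (⊕-mono eq x (⊖-⊆ eq F y))) (≤-reflexive (trans spans (sym same))))
      (ρ-mono (⊆-⊕ eq (F ⊖ y) x)))

  minimal-span-circuit : ∀ {F x} → F ⊆ₛ EM → EM x ≡ true → F x ≡ false → SpansMinimally F x
                       → Circuit eq M (F ⊕ x)
  minimal-span-circuit {F} {x} F⊆E x∈E Fx (spans , minimal) =
    ⊕-⊆ eq F⊆E x∈E , dependent , λ Y Y⊆C (z , Cz , Yz) → independent-⊆ (delete z Cz) (Y⊆C⊖z Y Y⊆C Yz)
    where
    C : Sub A
    C = F ⊕ x
    x∈G : x ∈ ground M
    x∈G = mem-∈ eq (ground M) x∈E
    F-indep : Independent eq M F
    F-indep = minimal-span-independent F⊆E (spans , minimal)
    dependent : ¬ Independent eq M C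
    dependent (_ , ρC) = 1+n≰n (begin
        suc (size F) ≡⟨ sym (size-⊕ F x∈G Fx) ⟩
        size C       ≡⟨ sym ρC ⟩
        ρ C          ≡⟨ spans ⟩
        ρ F          ≤⟨ ρ-size F ⟩
        size F       ∎)
      where open ≤-Reasoning
    delete : ∀ z → C z ≡ true → Independent eq M (C ⊖ z)
    delete z Cz with eq z x
    ... | yes refl = independent-≐ (λ w → sym (⊕⊖-cancel eq F Fx w)) F-indep
    ... | no z≢x = independent-≐ (⊖⊕-comm eq F z≢x) (⊕-⊆ eq D⊆E x∈E , ≤-antisym (ρ-size D) lower)
      where
      Fz : F z ≡ true
      Fz = trans (sym (∨-identityʳ (F z))) Cz
      D : Sub A
      D = (F ⊖ z) ⊕ x
      D⊆E : (F ⊖ z) ⊆ₛ EM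
      D⊆E w p = F⊆E w (⊖-⊆ eq F z w p)
      lower : size D ≤ ρ D
      lower = begin
        size D                ≡⟨ size-⊕ (F ⊖ z) x∈G (⊆-false x (⊖-⊆ eq F z) Fx) ⟩
        suc (size (F ⊖ z))    ≡⟨ cong suc (sym (proj₂ (independent-⊆ F-indep (⊖-⊆ eq F z)))) ⟩
        suc (ρ (F ⊖ z))       ≤⟨ ≤∧≢⇒< (ρ-mono (⊆-⊕ eq (F ⊖ z) x)) (λ e → minimal z Fz (sym e)) ⟩
        ρ D                   ∎
        where open ≤-Reasoning
    Y⊆C⊖z : ∀ Y → Y ⊆ₛ C → ∀ {z} → Y z ≡ false → Y ⊆ₛ (C ⊖ z)
    Y⊆C⊖z Y Y⊆C Yz w p = trans (⊖-other eq C (λ { refl → bool-clash p Yz })) (Y⊆C w p)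

  shrink : A → List A → Sub A → Sub A
  shrink x [] S = S
  shrink x (y ∷ l) S with S y | ρ ((S ⊖ y) ⊕ x) ≟ ρ (S ⊖ y)
  ... | true | yes _ = shrink x l (S ⊖ y)
  ... | true | no _ = shrink x l S
  ... | false | _ = shrink x l S

  shrink-⊆ : ∀ x l S → shrink x l S ⊆ₛ S
  shrink-⊆ x [] S z p = p
  shrink-⊆ x (y ∷ l) S z p with S y | ρ ((S ⊖ y) ⊕ x) ≟ ρ (S ⊖ y)
  ... | true | yes _ = ⊖-⊆ eq S y z (shrink-⊆ x l (S ⊖ y) z p)
  ... | true | no _ = shrink-⊆ x l S z p
  ... | false | _ = shrink-⊆ x l S z p

  shrink-spans : ∀ x l S → ρ (S ⊕ x) ≡ ρ S → ρ (shrink x l S ⊕ x) ≡ ρ (shrink x l S)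
  shrink-spans x [] S spans = spans
  shrink-spans x (y ∷ l) S spans with S y | ρ ((S ⊖ y) ⊕ x) ≟ ρ (S ⊖ y)
  ... | true | yes spans' = shrink-spans x l (S ⊖ y) spans'
  ... | true | no _ = shrink-spans x l S spans
  ... | false | _ = shrink-spans x l S spans

  shrink-minimal : ∀ x l S → S x ≡ false → ∀ y → y ∈ l → shrink x l S y ≡ true
                 → ρ ((shrink x l S ⊖ y) ⊕ x) ≢ ρ (shrink x l S ⊖ y)
  shrink-minimal x (w ∷ l) S Sx y y∈ p with S w in Sw | ρ ((S ⊖ w) ⊕ x) ≟ ρ (S ⊖ w)
  ... | true | yes _ with y∈
  ...   | here refl = ⊥-elim (bool-clash (shrink-⊆ x l (S ⊖ y) y p) (⊖-same eq S y))
  ...   | there y∈l = shrink-minimal x l (S ⊖ w) (⊆-false x (⊖-⊆ eq S w) Sx) y y∈l p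
  shrink-minimal x (w ∷ l) S Sx y y∈ p | true | no S⊖w-misses with y∈
  ... | here refl = λ spans → S⊖w-misses (closure-mono shrunk⊆ spans)
    where shrunk⊆ : (shrink x l S ⊖ y) ⊆ₛ (S ⊖ y)
          shrunk⊆ z q = trans (⊖-other eq S (⊖-≢ eq (shrink x l S) q)) (shrink-⊆ x l S z (⊖-⊆ eq (shrink x l S) y z q))
  ... | there y∈l = shrink-minimal x l S Sx y y∈l p
  shrink-minimal x (w ∷ l) S Sx y y∈ p | false | _ with y∈
  ... | here refl = ⊥-elim (bool-clash (shrink-⊆ x l S y p) Sw)
  ... | there y∈l = shrink-minimal x l S Sx y y∈l p

  circuit-through : ∀ B x → B ⊆ₛ EM → B x ≡ true → ρ (B ⊖ x) ≡ ρ B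
                  → ∃ λ C → Circuit eq M C × C ⊆ₛ B × C x ≡ true
  circuit-through B x B⊆E Bx same =
    F ⊕ x , minimal-span-circuit F⊆E (B⊆E x Bx) Fx (spans , minimal) , ⊕-⊆ eq F⊆B Bx , ⊕-same eq F x
    where
    F : Sub A
    F = shrink x (ground M) (B ⊖ x)
    F⊆B : F ⊆ₛ B
    F⊆B z p = ⊖-⊆ eq B x z (shrink-⊆ x (ground M) (B ⊖ x) z p)
    F⊆E : F ⊆ₛ EM
    F⊆E z p = B⊆E z (F⊆B z p)
    Fx : F x ≡ false
    Fx = ⊆-false x (shrink-⊆ x (ground M) (B ⊖ x)) (⊖-same eq B x)
    spans : ρ (F ⊕ x) ≡ ρ F
    spans = shrink-spans x (ground M) (B ⊖ x) (trans (ρ-≐ (⊖⊕-restore eq B Bx)) (sym same))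
    minimal : ∀ y → F y ≡ true → ρ ((F ⊖ y) ⊕ x) ≢ ρ (F ⊖ y)
    minimal y Fy = shrink-minimal x (ground M) (B ⊖ x) (⊖-same eq B x) y (mem-∈ eq (ground M) (F⊆E y Fy)) Fy

  private
    does-true : ∀ {P : Set} (d : Dec P) → does d ≡ true → P
    does-true (yes p) _ = p

    does-false : ∀ {P : Set} (d : Dec P) → does d ≡ false → ¬ P
    does-false (no ¬p) _ = ¬p

  closure : Sub A → Sub A
  closure Y x = EM x ∧ (Y x ∨ does (ρ (Y ⊕ x) ≟ ρ Y))

  nonColoops coloops : Sub A → Sub A
  nonColoops W x = W x ∧ does (ρ (W ⊖ x) ≟ ρ W)
  coloops W x = W x ∧ not (does (ρ (W ⊖ x) ≟ ρ W))

  ⊆-closure : ∀ Y → Y ⊆ₛ EM → Y ⊆ₛ closure Y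
  ⊆-closure Y Y⊆E z p rewrite Y⊆E z p | p = refl

  closure-rank : ∀ Y → Y ⊆ₛ EM → ρ (closure Y) ≡ ρ Y
  closure-rank Y Y⊆E = trans (sym (ρ-≐ (∪-absorb (⊆-closure Y Y⊆E)))) (closure-union Y (closure Y) spanned)
    where
    spanned : ∀ z → closure Y z ≡ true → ρ (Y ⊕ z) ≡ ρ Y
    spanned z p with Y z in Yz
    ... | true = ρ-≐ (⊕-absorb eq Y Yz)
    ... | false = does-true (ρ (Y ⊕ z) ≟ ρ Y) (∧-conicalʳ (EM z) _ p)

  closure-flat : ∀ Y → Y ⊆ₛ EM → Flat eq M (closure Y)
  closure-flat Y Y⊆E = (λ z p → ∧-conicalˡ (EM z) _ p) , outside
    where
    outside : ∀ x → EM x ≡ true → closure Y x ≡ false → ρ (closure Y ⊕ x) ≢ ρ (closure Y)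
    outside x x∈E x∉cl spans = bool-clash x∈cl x∉cl
      where
      Y-spans : ρ (Y ⊕ x) ≡ ρ Y
      Y-spans = ≤-antisym (begin
          ρ (Y ⊕ x)           ≤⟨ ρ-mono (⊕-mono eq x (⊆-closure Y Y⊆E)) ⟩
          ρ (closure Y ⊕ x)   ≡⟨ spans ⟩
          ρ (closure Y)       ≡⟨ closure-rank Y Y⊆E ⟩
          ρ Y                 ∎) (ρ-mono (⊆-⊕ eq Y x))
        where open ≤-Reasoning
      x∈cl : closure Y x ≡ true
      x∈cl = in-closure x∈E (dec-true (ρ (Y ⊕ x) ≟ ρ Y) Y-spans)
        where in-closure : ∀ {e y d} → e ≡ true → d ≡ true → e ∧ (y ∨ d) ≡ true
              in-closure {y = y} refl refl = ∨-zeroʳ y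

  nonColoops-⊆ : ∀ W → nonColoops W ⊆ₛ W
  nonColoops-⊆ W z p = ∧-conicalˡ (W z) _ p

  nonColoops-rank : ∀ W → W ⊆ₛ EM → ρ (nonColoops W) + size (coloops W) ≤ ρ W
  nonColoops-rank W W⊆E = subst (λ n → n + size (coloops W) ≤ ρ W) (ρ-≐ rest)
    (coloops-bound W (coloops W) W⊆E (λ z p → ∧-conicalˡ (W z) _ p) isColoop)
    where
    rest : (W ∖ coloops W) ≐ nonColoops W
    rest z with W z | does (ρ (W ⊖ z) ≟ ρ W)
    ... | true | true = refl
    ... | true | false = refl
    ... | false | _ = refl
    isColoop : ∀ z → coloops W z ≡ true → suc (ρ (W ⊖ z)) ≤ ρ W
    isColoop z p = ≤∧≢⇒< (ρ-mono (⊖-⊆ eq W z))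
      (does-false (ρ (W ⊖ z) ≟ ρ W) (not-true (∧-conicalʳ (W z) _ p)))

  nonColoops-cyclic : ∀ W → W ⊆ₛ EM → Cyclic eq M (nonColoops W)
  nonColoops-cyclic W W⊆E = W'⊆E , λ x p → circuit-through W' x W'⊆E p (keeps-rank x p)
    where
    W' : Sub A
    W' = nonColoops W
    W'⊆E : W' ⊆ₛ EM
    W'⊆E z p = W⊆E z (nonColoops-⊆ W z p)
    keeps-rank : ∀ x → W' x ≡ true → ρ (W' ⊖ x) ≡ ρ W'
    keeps-rank x p = ≤-antisym (ρ-mono (⊖-⊆ eq W' x)) (+-cancelʳ-≤ (size (coloops W)) _ _ (begin
        ρ W' + size (coloops W)                      ≤⟨ nonColoops-rank W W⊆E ⟩
        ρ W                                          ≡⟨ sym (does-true (ρ (W ⊖ x) ≟ ρ W) (∧-conicalʳ (W x) _ p)) ⟩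
        ρ (W ⊖ x)                                    ≤⟨ ρ-excess (W ⊖ x) (W' ⊖ x) ⟩
        ρ (W' ⊖ x) + size ((W ⊖ x) ∖ (W' ⊖ x))       ≤⟨ +-monoʳ-≤ (ρ (W' ⊖ x)) (count-mono (ground M) leftover) ⟩
        ρ (W' ⊖ x) + size (coloops W)                ∎))
      where
      open ≤-Reasoning
      leftover : ((W ⊖ x) ∖ (W' ⊖ x)) ⊆ₛ coloops W
      leftover z q with W z | does (ρ (W ⊖ z) ≟ ρ W) | does (eq z x)
      ... | true | false | _ = refl
      ... | true | true | true = q
      ... | true | true | false = q
      ... | false | _ | _ = q

  nonColoops-flat : ∀ W → Flat eq M W → Flat eq M (nonColoops W)
  nonColoops-flat W (W⊆E , W-closed) = (λ z p → W⊆E z (nonColoops-⊆ W z p)) , outside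
    where
    W' : Sub A
    W' = nonColoops W
    outside : ∀ x → EM x ≡ true → W' x ≡ false → ρ (W' ⊕ x) ≢ ρ W'
    outside x x∈E x∉W' spans = by-membership (W x) refl
      where
      W'⊆W⊖x : W' ⊆ₛ (W ⊖ x)
      W'⊆W⊖x z p = trans (⊖-other eq W (λ { refl → bool-clash p x∉W' })) (nonColoops-⊆ W z p)
      -- x ∉ W contradicts W being closed; x ∈ W contradicts x being a coloop of W
      by-membership : ∀ b → W x ≡ b → ⊥
      by-membership false Wx = W-closed x x∈E Wx (closure-mono (nonColoops-⊆ W) spans)
      by-membership true Wx = does-false (ρ (W ⊖ x) ≟ ρ W) x-coloop
        (≤-antisym (ρ-mono (⊖-⊆ eq W x)) (begin
          ρ W                 ≡⟨ sym (ρ-≐ (⊖⊕-restore eq W Wx)) ⟩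
          ρ ((W ⊖ x) ⊕ x)     ≡⟨ closure-mono W'⊆W⊖x spans ⟩
          ρ (W ⊖ x)           ∎))
        where
        open ≤-Reasoning
        x-coloop : does (ρ (W ⊖ x) ≟ ρ W) ≡ false
        x-coloop = trans (sym (cong (_∧ does (ρ (W ⊖ x) ≟ ρ W)) Wx)) x∉W'

  -- the rank formula for cyclic flats (one inequality): below every Y ⊆ E(M)
  -- there is a cyclic flat Z with r(Z) + |Y ∖ Z| ≤ r(Y)
  cyclic-flat-below : ∀ Y → Y ⊆ₛ EM → ∃ λ Z → CyclicFlat eq M Z × ρ Z + size (Y ∖ Z) ≤ ρ Y
  cyclic-flat-below Y Y⊆E =
    Z , (nonColoops-flat W (closure-flat Y Y⊆E) , nonColoops-cyclic W W⊆E) , (begin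
      ρ Z + size (Y ∖ Z)            ≤⟨ +-monoʳ-≤ (ρ Z) (count-mono (ground M) Y∖Z⊆coloops) ⟩
      ρ Z + size (coloops W)        ≤⟨ nonColoops-rank W W⊆E ⟩
      ρ W                           ≡⟨ closure-rank Y Y⊆E ⟩
      ρ Y                           ∎)
    where
    open ≤-Reasoning
    W Z : Sub A
    W = closure Y
    Z = nonColoops W
    W⊆E : W ⊆ₛ EM
    W⊆E z p = ∧-conicalˡ (EM z) _ p
    Y∖Z⊆coloops : (Y ∖ Z) ⊆ₛ coloops W
    Y∖Z⊆coloops z p = kept-out {Y z} {W z} (⊆-closure Y Y⊆E z (∖-⊆ Y Z z p)) p
      where kept-out : ∀ {y w d} → w ≡ true → y ∧ not (w ∧ d) ≡ true → w ∧ not d ≡ true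
            kept-out {true} refl q = q

module CyclicFlatFacts {A : Set} (eq : DecidableEquality A) (M : Matroid A) where

  open RankCalculus eq M

  cyclic-deletion : ∀ {F e} → Cyclic eq M F → F e ≡ true → ρ (F ⊖ e) ≡ ρ F
  cyclic-deletion {F} {e} (F⊆E , on-circuit) Fe with on-circuit e Fe
  ... | C , (C⊆E , C-dep , C-min) , C⊆F , Ce = sym (begin-equality
      ρ F                 ≡⟨ sym (ρ-≐ (⊖⊕-restore eq F Fe)) ⟩
      ρ ((F ⊖ e) ⊕ e)     ≡⟨ closure-mono C⊖e⊆F⊖e C⊖e-spans ⟩
      ρ (F ⊖ e)           ∎)
    where
    open ≤-Reasoning
    C⊖e-indep : Independent eq M (C ⊖ e)
    C⊖e-indep = C-min (C ⊖ e) (⊖-⊆ eq C e) (e , Ce , ⊖-same eq C e)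
    C⊖e-spans : ρ ((C ⊖ e) ⊕ e) ≡ ρ (C ⊖ e)
    C⊖e-spans = trans (ρ-≐ (⊖⊕-restore eq C Ce)) (≤-antisym (≤-pred (begin-strict
        ρ C                   <⟨ ≤∧≢⇒< (ρ-size C) (λ same → C-dep (C⊆E , same)) ⟩
        size C                ≡⟨ count-remove eq C (ground M) (ground-unique M) (mem-∈ eq (ground M) (C⊆E e Ce)) Ce ⟩
        suc (size (C ⊖ e))    ≡⟨ cong suc (sym (proj₂ C⊖e-indep)) ⟩
        suc (ρ (C ⊖ e))       ∎)) (ρ-mono (⊖-⊆ eq C e)))
    C⊖e⊆F⊖e : (C ⊖ e) ⊆ₛ (F ⊖ e)
    C⊖e⊆F⊖e z p = trans (⊖-other eq F (⊖-≢ eq C p)) (C⊆F z (⊖-⊆ eq C e z p))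

  cyclic-rank-drop : ∀ {F S e} → Cyclic eq M F → S ⊆ₛ F → F e ≡ true → S e ≡ false
                   → suc (ρ F) ≤ ρ S + size (F ∖ S)
  cyclic-rank-drop {F} {S} {e} F-cyc S⊆F Fe Se = begin
      suc (ρ F)                          ≡⟨ cong suc (sym (cyclic-deletion F-cyc Fe)) ⟩
      suc (ρ (F ⊖ e))                    ≤⟨ s≤s (ρ-excess (F ⊖ e) S) ⟩
      suc (ρ S + size ((F ⊖ e) ∖ S))     ≡⟨ sym (+-suc (ρ S) _) ⟩
      ρ S + suc (size ((F ⊖ e) ∖ S))     ≡⟨ cong (ρ S +_) (sym size-F∖S) ⟩
      ρ S + size (F ∖ S)                 ∎
    where
    open ≤-Reasoning
    F∖S-e : (F ∖ S) e ≡ true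
    F∖S-e rewrite Fe | Se = refl
    size-F∖S : size (F ∖ S) ≡ suc (size ((F ⊖ e) ∖ S))
    size-F∖S = trans (count-remove eq (F ∖ S) (ground M) (ground-unique M)
                        (mem-∈ eq (ground M) (proj₁ F-cyc e Fe)) F∖S-e)
                     (cong suc (count-≐ (ground M) (λ z → ∧-swapʳ (F z) _ _)))

  cyclic-nullity : ∀ {F e} → Cyclic eq M F → F e ≡ true → suc (ρ F) ≤ size F
  cyclic-nullity {F} F-cyc Fe = subst₂ (λ a b → suc (ρ F) ≤ a + b) ρ-∅ (count-≐ (ground M) F∖∅)
    (cyclic-rank-drop F-cyc (λ _ ()) Fe refl)
    where F∖∅ : (F ∖ ∅ₛ) ≐ F
          F∖∅ z = ∧-identityʳ (F z)

  flat-rank-grows : ∀ {F S e} → Flat eq M F → EM e ≡ true → F e ≡ false → (F ⊕ e) ⊆ₛ S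
                  → suc (ρ F) ≤ ρ S
  flat-rank-grows {F} {S} {e} (_ , closed) e∈E Fe F+e⊆S =
    ≤-trans (≤∧≢⇒< (ρ-mono (⊆-⊕ eq F e)) (λ same → closed e e∈E Fe (sym same))) (ρ-mono F+e⊆S)

  Z'-≐ : ∀ {X Y} → Z' eq M X → X ≐ Y → Z' eq M Y
  Z'-≐ {X} {Y} (((X⊆E , closed) , (_ , on-circuit)) , (w , Xw) , (v , v∈E , Xv)) X≐Y =
    ((Y⊆E , closed') , (Y⊆E , on-circuit')) , (w , trans (sym (X≐Y w)) Xw) , (v , v∈E , trans (sym (X≐Y v)) Xv)
    where
    Y⊆E : Y ⊆ₛ EM
    Y⊆E z p = X⊆E z (trans (X≐Y z) p)
    closed' : ∀ x → EM x ≡ true → Y x ≡ false → ρ (Y ⊕ x) ≢ ρ Y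
    closed' x x∈E Yx same = closed x x∈E (trans (X≐Y x) Yx)
      (trans (ρ-≐ (λ z → cong (_∨ does (eq z x)) (X≐Y z))) (trans same (sym (ρ-≐ X≐Y))))
    on-circuit' : ∀ x → Y x ≡ true → ∃ λ C → Circuit eq M C × C ⊆ₛ Y × C x ≡ true
    on-circuit' x Yx with on-circuit x (trans (X≐Y x) Yx)
    ... | C , C-circ , C⊆X , Cx = C , C-circ , (λ z p → trans (sym (X≐Y z)) (C⊆X z p)) , Cx

  cyclic-flat-cases : ∀ Z → CyclicFlat eq M Z → (Z ≐ ∅ₛ) ⊎ (Z ≐ EM) ⊎ Z' eq M Z
  cyclic-flat-cases Z Z-cf with search Z (ground M)
  ... | inj₂ none = inj₁ empty
    where empty : Z ≐ ∅ₛ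
          empty x with Z x in Zx
          ... | true = ⊥-elim (bool-clash Zx (none x (mem-∈ eq (ground M) (proj₁ (proj₁ Z-cf) x Zx))))
          ... | false = refl
  ... | inj₁ (w , w∈G , Zw) with search (λ x → not (Z x)) (ground M)
  ...   | inj₁ (v , v∈G , not-Zv) = inj₂ (inj₂ (Z-cf , (w , Zw) , (v , ∈-mem eq v∈G , not-true not-Zv)))
  ...   | inj₂ all = inj₂ (inj₁ (⊆-antisym (proj₁ (proj₁ Z-cf)) E⊆Z))
    where E⊆Z : EM ⊆ₛ Z
          E⊆Z x x∈E = not-false (all x (mem-∈ eq (ground M) x∈E))

  no-Z'⇒uniform : (∀ Z → ¬ Z' eq M Z) → Uniform eq M
  no-Z'⇒uniform no-Z' X X⊆E size≡r with cyclic-flat-below X X⊆E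
  ... | Z , Z-cf , below = X⊆E , ≤-antisym (ρ-size X) (by-cases (cyclic-flat-cases Z Z-cf))
    where
    by-cases : (Z ≐ ∅ₛ) ⊎ (Z ≐ EM) ⊎ Z' eq M Z → size X ≤ ρ X
    by-cases (inj₁ Z≐∅) = ≤-trans (≤-reflexive (count-≐ (ground M) X≐X∖Z)) (m+n≤o⇒n≤o (ρ Z) below)
      where X≐X∖Z : X ≐ (X ∖ Z)
            X≐X∖Z x rewrite Z≐∅ x = sym (∧-identityʳ (X x))
    by-cases (inj₂ (inj₁ Z≐E)) = begin
        size X    ≡⟨ size≡r ⟩
        ρ EM      ≡⟨ sym (ρ-≐ Z≐E) ⟩
        ρ Z       ≤⟨ m+n≤o⇒m≤o (ρ Z) below ⟩
        ρ X       ∎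
      where open ≤-Reasoning
    by-cases (inj₂ (inj₂ Z∈Z')) = ⊥-elim (no-Z' Z Z∈Z')

  Differs : Sub A → Sub A → Set
  Differs F S = (∃ λ e → EM e ≡ true × S e ≡ true × F e ≡ false)
              ⊎ (S ⊆ₛ F × ∃ λ e → F e ≡ true × S e ≡ false)

  ¬Differs⇒≐ : ∀ {F S} → F ⊆ₛ EM → S ⊆ₛ EM → ¬ Differs F S → F ≐ S
  ¬Differs⇒≐ {F} {S} F⊆E S⊆E same = ⊆-antisym F⊆S S⊆F
    where
    S⊆F : S ⊆ₛ F
    S⊆F x Sx with F x in Fx
    ... | true = refl
    ... | false = ⊥-elim (same (inj₁ (x , S⊆E x Sx , Sx , Fx)))
    F⊆S : F ⊆ₛ S
    F⊆S x Fx with S x in Sx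
    ... | true = refl
    ... | false = ⊥-elim (same (inj₂ (S⊆F , x , Fx , Sx)))

  some-Z'-differs : ∀ {S} → S ⊆ₛ EM → ¬ Uniform eq M → ¬ Z'IsSingleton eq M S
                  → ¬ (∀ F → Z' eq M F → ¬ Differs F S)
  some-Z'-differs {S} S⊆E non-uniform not-only-S none-differ =
    non-uniform (no-Z'⇒uniform λ Z Z∈Z' → not-only-S (Z'-≐ Z∈Z' (equal Z Z∈Z') , equal))
    where equal : ∀ Z → Z' eq M Z → Z ≐ S
          equal Z Z∈Z' = ¬Differs⇒≐ (proj₁ (proj₁ (proj₁ Z∈Z'))) S⊆E (none-differ Z Z∈Z')

-- Let N be a matroid on a
-- subset of E(M) and P ⊆ E(M) disjoint from E(N) such that r(M) = r(N) + |P|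
-- and every cyclic flat of M is ∅, E(M), a lift F ∪ P of some F ∈ 𝒵'(N) of
-- rank r_N(F) + |P|, or an "other" cyclic flat meeting E(N) in S and of rank
-- large enough.  Then N = M / P restricted to E(N), and when N is neither
-- uniform nor has 𝒵'(N) = {S}, P is the only set whose contraction gives N.

module Contraction {A : Set} (eq : DecidableEquality A) (M N : Matroid A) (S P : Sub A) (k : ℕ)
  (Other : Sub A → Set)
  (EN⊆EM : E eq N ⊆ₛ E eq M) (P⊆EM : P ⊆ₛ E eq M) (P∩EN : ∀ x → P x ≡ true → E eq N x ≡ false)
  (S⊆EN : S ⊆ₛ E eq N) (rM≡k : r eq M ≡ k) (rN+|P|≡k : r eq N + card eq M P ≡ k)
  (cyclic-flats : ∀ Z → CyclicFlat eq M Z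
                → (Z ≐ ∅ₛ) ⊎ (Z ≐ E eq M) ⊎ (∃ λ F → Z' eq N F × Z ≐ (F ∪ₛ P)) ⊎ Other Z)
  (lift-rank : ∀ F → Z' eq N F → rk M (F ∪ₛ P) ≡ rk N F + card eq M P)
  (other-meets-S : ∀ Z → Other Z → ∀ x → E eq N x ≡ true → Z x ≡ S x)
  (other-rank : ∀ Z → Other Z → r eq N + card eq M P ≤ rk M Z + card eq M (P ∖ Z)) where

  open RankCalculus eq M
  module N = RankCalculus eq N
  module NF = CyclicFlatFacts eq N
  open ≤-Reasoning

  EN : Sub A
  EN = E eq N

  rN : ℕ
  rN = r eq N

  private
    +-swapʳ : ∀ a b c → (a + b) + c ≡ (a + c) + b
    +-swapʳ = solve-∀

  EN∩P : ∀ x → EN x ≡ true → P x ≡ false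
  EN∩P x x∈EN with P x in Px
  ... | true = ⊥-elim (bool-clash x∈EN (P∩EN x Px))
  ... | false = refl

  size-in-N : ∀ X → X ⊆ₛ EN → size X ≡ N.size X
  size-in-N X X⊆EN = count-sublist eq X (ground N) (ground M) (ground-unique N) (ground-unique M) X⊆EN
    (λ x x∈ → mem-∈ eq (ground M) (EN⊆EM x (∈-mem eq x∈)))

  size-∖-in-N : ∀ X Y → X ⊆ₛ EN → size (X ∖ Y) ≡ N.size (X ∖ Y)
  size-∖-in-N X Y X⊆EN = size-in-N (X ∖ Y) (λ z p → X⊆EN z (∖-⊆ X Y z p))

  size-∪P : ∀ X → X ⊆ₛ EN → size (X ∪ₛ P) ≡ N.size X + size P
  size-∪P X X⊆EN = trans (count-union X P (ground M) (λ x Xx → EN∩P x (X⊆EN x Xx)))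
                         (cong (_+ size P) (size-in-N X X⊆EN))

  lift-≤ : ∀ Z → CyclicFlat eq N Z → ρ (Z ∪ₛ P) ≤ N.ρ Z + size P
  lift-≤ Z Z-cf with NF.cyclic-flat-cases Z Z-cf
  ... | inj₁ Z≐∅ = begin
      ρ (Z ∪ₛ P)        ≡⟨ ρ-≐ (λ x → cong (_∨ P x) (Z≐∅ x)) ⟩
      ρ P               ≤⟨ ρ-size P ⟩
      size P            ≡⟨ cong (_+ size P) (sym (trans (N.ρ-≐ Z≐∅) N.ρ-∅)) ⟩
      N.ρ Z + size P    ∎
  ... | inj₂ (inj₁ Z≐EN) = begin
      ρ (Z ∪ₛ P)        ≤⟨ ρ-mono (∪-⊆ (λ x Zx → EN⊆EM x (trans (sym (Z≐EN x)) Zx)) P⊆EM) ⟩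
      ρ EM              ≡⟨ trans rM≡k (sym rN+|P|≡k) ⟩
      rN + size P       ≡⟨ cong (_+ size P) (sym (N.ρ-≐ Z≐EN)) ⟩
      N.ρ Z + size P    ∎
  ... | inj₂ (inj₂ Z∈Z') = ≤-reflexive (lift-rank Z Z∈Z')

  -- upper bound: r_M(X ∪ P) ≤ r_N(X) + |P|, via a cyclic flat of N below X
  rank-∪P-≤ : ∀ X → X ⊆ₛ EN → ρ (X ∪ₛ P) ≤ N.ρ X + size P
  rank-∪P-≤ X X⊆EN with N.cyclic-flat-below X X⊆EN
  ... | Z , Z-cf , below = begin
      ρ (X ∪ₛ P)                                   ≤⟨ ρ-excess (X ∪ₛ P) (Z ∪ₛ P) ⟩
      ρ (Z ∪ₛ P) + size ((X ∪ₛ P) ∖ (Z ∪ₛ P))      ≤⟨ +-mono-≤ (lift-≤ Z Z-cf) (count-mono (ground M) (∪∖∪-⊆ X P Z)) ⟩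
      (N.ρ Z + size P) + size (X ∖ Z)              ≡⟨ cong ((N.ρ Z + size P) +_) (size-∖-in-N X Z X⊆EN) ⟩
      (N.ρ Z + size P) + N.size (X ∖ Z)            ≡⟨ +-swapʳ (N.ρ Z) (size P) _ ⟩
      (N.ρ Z + N.size (X ∖ Z)) + size P            ≤⟨ +-monoˡ-≤ (size P) below ⟩
      N.ρ X + size P                               ∎

  cyclic-flat-lower : ∀ Z → CyclicFlat eq M Z → ∀ X → X ⊆ₛ EN → N.ρ X + size P ≤ ρ Z + size ((X ∪ₛ P) ∖ Z)
  cyclic-flat-lower Z Z-cf X X⊆EN with cyclic-flats Z Z-cf
  ... | inj₁ Z≐∅ = begin
      N.ρ X + size P            ≤⟨ +-monoˡ-≤ (size P) (N.ρ-size X) ⟩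
      N.size X + size P         ≡⟨ sym (size-∪P X X⊆EN) ⟩
      size (X ∪ₛ P)             ≡⟨ count-≐ (ground M) (λ x → sym (∖-empty (X ∪ₛ P) Z≐∅ x)) ⟩
      size ((X ∪ₛ P) ∖ Z)       ≤⟨ m≤n+m _ (ρ Z) ⟩
      ρ Z + size ((X ∪ₛ P) ∖ Z) ∎
  ... | inj₂ (inj₁ Z≐EM) = begin
      N.ρ X + size P            ≤⟨ +-monoˡ-≤ (size P) (N.ρ-mono X⊆EN) ⟩
      rN + size P               ≡⟨ trans rN+|P|≡k (sym rM≡k) ⟩
      ρ EM                      ≡⟨ sym (ρ-≐ Z≐EM) ⟩
      ρ Z                       ≤⟨ m≤m+n (ρ Z) _ ⟩
      ρ Z + size ((X ∪ₛ P) ∖ Z) ∎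
  ... | inj₂ (inj₂ (inj₁ (F , F∈Z' , Z≐F∪P))) = begin
      N.ρ X + size P                      ≤⟨ +-monoˡ-≤ (size P) (N.ρ-excess X F) ⟩
      (N.ρ F + N.size (X ∖ F)) + size P   ≡⟨ +-swapʳ (N.ρ F) _ (size P) ⟩
      (N.ρ F + size P) + N.size (X ∖ F)   ≡⟨ cong₂ _+_ (sym (trans (ρ-≐ Z≐F∪P) (lift-rank F F∈Z')))
                                                        (sym (size-∖-in-N X F X⊆EN)) ⟩
      ρ Z + size (X ∖ F)                  ≤⟨ +-monoʳ-≤ (ρ Z) (count-mono (ground M) X∖F⊆) ⟩
      ρ Z + size ((X ∪ₛ P) ∖ Z)           ∎
    where
    X∖F⊆ : (X ∖ F) ⊆ₛ ((X ∪ₛ P) ∖ Z)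
    X∖F⊆ x p = trans (∖-congʳ (X ∪ₛ P) Z≐F∪P x) (∖-⊆-∪∖∪ F (λ z Xz → EN∩P z (X⊆EN z Xz)) x p)
  ... | inj₂ (inj₂ (inj₂ other)) = begin
      N.ρ X + size P                      ≤⟨ +-monoˡ-≤ (size P) (N.ρ-mono X⊆EN) ⟩
      rN + size P                         ≤⟨ other-rank Z other ⟩
      ρ Z + size (P ∖ Z)                  ≤⟨ +-monoʳ-≤ (ρ Z) (count-mono (ground M) (∖-monoˡ Z (⊆-∪ʳ X P))) ⟩
      ρ Z + size ((X ∪ₛ P) ∖ Z)           ∎

  -- lower bound, via a cyclic flat of M below X ∪ P
  rank-∪P-≥ : ∀ X → X ⊆ₛ EN → N.ρ X + size P ≤ ρ (X ∪ₛ P)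
  rank-∪P-≥ X X⊆EN with cyclic-flat-below (X ∪ₛ P) (∪-⊆ (λ x p → EN⊆EM x (X⊆EN x p)) P⊆EM)
  ... | Z , Z-cf , below = ≤-trans (cyclic-flat-lower Z Z-cf X X⊆EN) below

  rank-∪P : ∀ X → X ⊆ₛ EN → ρ (X ∪ₛ P) ≡ N.ρ X + size P
  rank-∪P X X⊆EN = ≤-antisym (rank-∪P-≤ X X⊆EN) (rank-∪P-≥ X X⊆EN)

  is-minor : IsMinor eq N M
  is-minor = P , P⊆EM , EN⊆EM , EN∩P , λ X → sym (begin-equality
      ρ ((X ∩ₛ EN) ∪ₛ P) ∸ ρ P                  ≡⟨ cong₂ _∸_ (rank-∪P (X ∩ₛ EN) (λ x p → ∧-conicalʳ (X x) _ p)) ρP ⟩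
      (N.ρ (X ∩ₛ EN) + size P) ∸ size P         ≡⟨ m+n∸n≡m (N.ρ (X ∩ₛ EN)) (size P) ⟩
      N.ρ (X ∩ₛ EN)                             ≡⟨ rk-ext N _ _ (λ x x∈ → trans (cong (X x ∧_) (∈-mem eq x∈)) (∧-identityʳ (X x))) ⟩
      N.ρ X                                     ∎)
    where
    ρP : ρ P ≡ size P
    ρP = trans (rank-∪P ∅ₛ (λ _ ())) (cong (_+ size P) N.ρ-∅)

  module Uniqueness (K : Sub A) (K⊆EM : K ⊆ₛ EM) (K∩EN : ∀ x → EN x ≡ true → K x ≡ false)
    (contracts : ∀ X → N.ρ X + ρ K ≡ ρ ((X ∩ₛ EN) ∪ₛ K)) where

    rank-∪K : ∀ X → X ⊆ₛ EN → ρ (X ∪ₛ K) ≡ N.ρ X + ρ K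
    rank-∪K X X⊆EN = sym (trans (contracts X) (ρ-≐ (λ x → cong (_∨ K x) (∩-absorb X⊆EN x))))

    outside-EN : ∀ x → K x ≡ true → EN x ≡ false
    outside-EN x Kx with EN x in x∈EN
    ... | true = ⊥-elim (bool-clash Kx (K∩EN x x∈EN))
    ... | false = refl

    -- r(N) + r(K) ≤ r(M) = r(N) + |P|, so r(K) ≤ |P|
    rN+ρK≤k : rN + ρ K ≤ k
    rN+ρK≤k = begin
      rN + ρ K         ≡⟨ sym (rank-∪K EN (λ _ p → p)) ⟩
      ρ (EN ∪ₛ K)      ≤⟨ ρ-mono (∪-⊆ EN⊆EM K⊆EM) ⟩
      ρ EM             ≡⟨ rM≡k ⟩
      k                ∎

    ρK≤|P| : ρ K ≤ size P
    ρK≤|P| = +-cancelˡ-≤ rN _ _ (≤-trans rN+ρK≤k (≤-reflexive (sym rN+|P|≡k)))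

    Mismatch : A → Set
    Mismatch x = (K x ≡ true × P x ≡ false) ⊎ (P x ≡ true × K x ≡ false)

    -- a mismatch makes K ∖ P or P ∖ K nonempty, which costs one unit
    mismatch-bound : ∀ {x} → Mismatch x → suc (ρ K) ≤ size P + size (K ∖ P)
    mismatch-bound {x} (inj₁ (Kx , Px)) = begin
        suc (ρ K)                          ≤⟨ s≤s ρK≤|P| ⟩
        suc (size P)                       ≤⟨ s≤s (m≤m+n (size P) (size ((K ∖ P) ⊖ x))) ⟩
        suc (size P + size ((K ∖ P) ⊖ x))  ≡⟨ sym (+-suc (size P) _) ⟩
        size P + suc (size ((K ∖ P) ⊖ x))  ≡⟨ cong (size P +_) (sym (count-remove eq (K ∖ P) (ground M) (ground-unique M)
                                                   (mem-∈ eq (ground M) (K⊆EM x Kx)) K∖P-x)) ⟩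
        size P + size (K ∖ P)              ∎
      where K∖P-x : (K ∖ P) x ≡ true
            K∖P-x rewrite Kx | Px = refl
    mismatch-bound {x} (inj₂ (Px , Kx)) = begin
        suc (ρ K)                          ≤⟨ s≤s (ρ-size K) ⟩
        suc (size K)                       ≡⟨ cong suc (count-split K P (ground M)) ⟩
        suc (size (K ∩ₛ P) + size (K ∖ P)) ≤⟨ s≤s (+-monoˡ-≤ _ (count-mono (ground M) K∩P⊆P⊖x)) ⟩
        suc (size (P ⊖ x)) + size (K ∖ P)  ≡⟨ cong (_+ size (K ∖ P)) (sym (count-remove eq P (ground M) (ground-unique M)
                                                   (mem-∈ eq (ground M) (P⊆EM x Px)) Px)) ⟩
        size P + size (K ∖ P)              ∎
      where K∩P⊆P⊖x : (K ∩ₛ P) ⊆ₛ (P ⊖ x)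
            K∩P⊆P⊖x z p = trans (⊖-other eq P (λ { refl → bool-clash (∧-conicalˡ (K z) _ p) Kx }))
                                (∧-conicalʳ (K z) _ p)

    -- any F ∈ 𝒵'(N) differing from S rules out a mismatch: no cyclic flat of M
    -- can realise the rank r_N(F) + r_M(K) of F ∪ K
    module Against (F : Sub A) (F∈Z' : Z' eq N F) where

      F⊆EN : F ⊆ₛ EN
      F⊆EN = proj₁ (proj₁ (proj₁ F∈Z'))

      F∩K : ∀ x → F x ≡ true → K x ≡ false
      F∩K x Fx = K∩EN x (F⊆EN x Fx)

      ρ-F∪K : ρ (F ∪ₛ K) ≡ N.ρ F + ρ K
      ρ-F∪K = rank-∪K F F⊆EN

      -- Z = ∅: F ∪ K would be independent, but F is dependent
      vs-empty : suc (N.ρ F + ρ K) ≤ size (F ∪ₛ K)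
      vs-empty with proj₁ (proj₂ F∈Z')
      ... | w , Fw = begin
          suc (N.ρ F) + ρ K     ≤⟨ +-mono-≤ (NF.cyclic-nullity (proj₂ (proj₁ F∈Z')) Fw) (ρ-size K) ⟩
          N.size F + size K     ≡⟨ cong (_+ size K) (sym (size-in-N F F⊆EN)) ⟩
          size F + size K       ≡⟨ sym (count-union F K (ground M) F∩K) ⟩
          size (F ∪ₛ K)         ∎

      -- Z = E(M): F is a proper flat, so r_N(F) < r(N)
      vs-full : suc (N.ρ F + ρ K) ≤ ρ EM
      vs-full with proj₂ (proj₂ F∈Z')
      ... | v , v∈EN , Fv = begin
          suc (N.ρ F) + ρ K     ≤⟨ +-monoˡ-≤ (ρ K) (NF.flat-rank-grows (proj₁ (proj₁ F∈Z')) v∈EN Fv (⊕-⊆ eq F⊆EN v∈EN)) ⟩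
          rN + ρ K              ≤⟨ rN+ρK≤k ⟩
          k                     ≡⟨ sym rM≡k ⟩
          ρ EM                  ∎

      -- Z = F' ∪ P: only possible when K = P
      vs-lift : ∀ {x} F' → Z' eq N F' → Mismatch x
              → suc (N.ρ F + ρ K) ≤ (N.ρ F' + size P) + size ((F ∪ₛ K) ∖ (F' ∪ₛ P))
      vs-lift F' F'∈Z' mismatch = begin
          suc (N.ρ F + ρ K)                                  ≡⟨ sym (+-suc (N.ρ F) (ρ K)) ⟩
          N.ρ F + suc (ρ K)                                  ≤⟨ +-mono-≤ (N.ρ-excess F F') (mismatch-bound mismatch) ⟩
          (N.ρ F' + N.size (F ∖ F')) + (size P + size (K ∖ P)) ≡⟨ regroup (N.ρ F') _ (size P) _ ⟩
          (N.ρ F' + size P) + (N.size (F ∖ F') + size (K ∖ P)) ≡⟨ cong (λ n → (N.ρ F' + size P) + (n + size (K ∖ P)))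
                                                                    (sym (size-∖-in-N F F' F⊆EN)) ⟩
          (N.ρ F' + size P) + (size (F ∖ F') + size (K ∖ P))   ≡⟨ cong ((N.ρ F' + size P) +_) (sym (count-union (F ∖ F') (K ∖ P) (ground M) disjoint)) ⟩
          (N.ρ F' + size P) + size ((F ∖ F') ∪ₛ (K ∖ P))       ≤⟨ +-monoʳ-≤ (N.ρ F' + size P) (count-mono (ground M) parts⊆) ⟩
          (N.ρ F' + size P) + size ((F ∪ₛ K) ∖ (F' ∪ₛ P))      ∎
        where
        regroup : ∀ a b c d → (a + b) + (c + d) ≡ (a + c) + (b + d)
        regroup = solve-∀
        disjoint : ∀ z → (F ∖ F') z ≡ true → (K ∖ P) z ≡ false
        disjoint z p rewrite F∩K z (∖-⊆ F F' z p) = refl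
        parts⊆ : ((F ∖ F') ∪ₛ (K ∖ P)) ⊆ₛ ((F ∪ₛ K) ∖ (F' ∪ₛ P))
        parts⊆ = ∪-⊆ F∖F'⊆ K∖P⊆
          where
          F'⊆EN : F' ⊆ₛ EN
          F'⊆EN = proj₁ (proj₁ (proj₁ F'∈Z'))
          F∖F'⊆ : (F ∖ F') ⊆ₛ ((F ∪ₛ K) ∖ (F' ∪ₛ P))
          F∖F'⊆ z p = ∈-∖ (F ∪ₛ K) (F' ∪ₛ P) (⊆-∪ˡ F K z Fz)
                        (∉-∪ F' P (not-true (∧-conicalʳ (F z) _ p)) (EN∩P z (F⊆EN z Fz)))
            where Fz : F z ≡ true
                  Fz = ∧-conicalˡ (F z) _ p
          K∖P⊆ : (K ∖ P) ⊆ₛ ((F ∪ₛ K) ∖ (F' ∪ₛ P))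
          K∖P⊆ z p = ∈-∖ (F ∪ₛ K) (F' ∪ₛ P) (⊆-∪ʳ F K z Kz)
                        (∉-∪ F' P (⊆-false z F'⊆EN (outside-EN z Kz)) (not-true (∧-conicalʳ (K z) _ p)))
            where Kz : K z ≡ true
                  Kz = ∧-conicalˡ (K z) _ p

      -- Z an "other" cyclic flat, meeting E(N) in S: ruled out because F differs from S
      module _ (Z : Sub A) (Z∩EN≐S : ∀ x → EN x ≡ true → Z x ≡ S x) where

        split : ∀ X → X ⊆ₛ EN → size ((X ∪ₛ K) ∖ Z) ≡ N.size (X ∖ S) + size (K ∖ Z)
        split X X⊆EN = begin-equality
            size ((X ∪ₛ K) ∖ Z)                ≡⟨ count-≐ (ground M) pieces ⟩
            size ((X ∖ S) ∪ₛ (K ∖ Z))          ≡⟨ count-union (X ∖ S) (K ∖ Z) (ground M) disjoint ⟩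
            size (X ∖ S) + size (K ∖ Z)        ≡⟨ cong (_+ size (K ∖ Z)) (size-∖-in-N X S X⊆EN) ⟩
            N.size (X ∖ S) + size (K ∖ Z)      ∎
          where
          pieces : ((X ∪ₛ K) ∖ Z) ≐ ((X ∖ S) ∪ₛ (K ∖ Z))
          pieces z with X z in Xz
          ... | true rewrite K∩EN z (X⊆EN z Xz) | Z∩EN≐S z (X⊆EN z Xz) = sym (∨-identityʳ (not (S z)))
          ... | false = refl
          disjoint : ∀ z → (X ∖ S) z ≡ true → (K ∖ Z) z ≡ false
          disjoint z p rewrite K∩EN z (X⊆EN z (∖-⊆ X S z p)) = refl

        upper : ∀ X → X ⊆ₛ EN → N.ρ X + ρ K ≤ ρ Z + (N.size (X ∖ S) + size (K ∖ Z))
        upper X X⊆EN = begin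
            N.ρ X + ρ K                          ≡⟨ sym (rank-∪K X X⊆EN) ⟩
            ρ (X ∪ₛ K)                           ≤⟨ ρ-excess (X ∪ₛ K) Z ⟩
            ρ Z + size ((X ∪ₛ K) ∖ Z)            ≡⟨ cong (ρ Z +_) (split X X⊆EN) ⟩
            ρ Z + (N.size (X ∖ S) + size (K ∖ Z)) ∎

        vs-other : NF.Differs F S → suc (N.ρ F + ρ K) ≤ ρ Z + size ((F ∪ₛ K) ∖ Z)
        vs-other (inj₁ (e , e∈EN , Se , Fe)) = begin
            suc (N.ρ F) + ρ K                      ≤⟨ +-monoˡ-≤ (ρ K) (NF.flat-rank-grows (proj₁ (proj₁ F∈Z')) e∈EN Fe
                                                         (⊕-⊆ eq (⊆-∪ˡ F S) (⊆-∪ʳ F S e Se))) ⟩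
            N.ρ (F ∪ₛ S) + ρ K                     ≤⟨ upper (F ∪ₛ S) (∪-⊆ F⊆EN S⊆EN) ⟩
            ρ Z + (N.size ((F ∪ₛ S) ∖ S) + size (K ∖ Z)) ≡⟨ cong (λ n → ρ Z + (n + size (K ∖ Z))) (count-≐ (ground N) (∪∖-cancel F S)) ⟩
            ρ Z + (N.size (F ∖ S) + size (K ∖ Z))  ≡⟨ cong (ρ Z +_) (sym (split F F⊆EN)) ⟩
            ρ Z + size ((F ∪ₛ K) ∖ Z)              ∎
        vs-other (inj₂ (S⊆F , e , Fe , Se)) = begin
            suc (N.ρ F) + ρ K                      ≤⟨ +-monoˡ-≤ (ρ K) (NF.cyclic-rank-drop (proj₂ (proj₁ F∈Z')) S⊆F Fe Se) ⟩
            (N.ρ S + N.size (F ∖ S)) + ρ K         ≡⟨ +-swapʳ (N.ρ S) _ (ρ K) ⟩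
            (N.ρ S + ρ K) + N.size (F ∖ S)         ≤⟨ +-monoˡ-≤ _ (upper S S⊆EN) ⟩
            (ρ Z + (N.size (S ∖ S) + size (K ∖ Z))) + N.size (F ∖ S)
                                                   ≡⟨ cong (λ n → (ρ Z + (n + size (K ∖ Z))) + N.size (F ∖ S))
                                                        (trans (count-≐ (ground N) (∖-self S)) (count-∅ (ground N))) ⟩
            (ρ Z + size (K ∖ Z)) + N.size (F ∖ S)  ≡⟨ +-rotate (ρ Z) _ _ ⟩
            ρ Z + (N.size (F ∖ S) + size (K ∖ Z))  ≡⟨ cong (ρ Z +_) (sym (split F F⊆EN)) ⟩
            ρ Z + size ((F ∪ₛ K) ∖ Z)              ∎
          where
          +-rotate : ∀ a b c → (a + b) + c ≡ a + (c + b)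
          +-rotate = solve-∀

      vs-any : ∀ {x} → Mismatch x → NF.Differs F S → ∀ Z → CyclicFlat eq M Z
             → suc (N.ρ F + ρ K) ≤ ρ Z + size ((F ∪ₛ K) ∖ Z)
      vs-any mismatch differs Z Z-cf with cyclic-flats Z Z-cf
      ... | inj₁ Z≐∅ = begin
          suc (N.ρ F + ρ K)            ≤⟨ vs-empty ⟩
          size (F ∪ₛ K)                ≡⟨ count-≐ (ground M) (λ z → sym (∖-empty (F ∪ₛ K) Z≐∅ z)) ⟩
          size ((F ∪ₛ K) ∖ Z)          ≤⟨ m≤n+m _ (ρ Z) ⟩
          ρ Z + size ((F ∪ₛ K) ∖ Z)    ∎
      ... | inj₂ (inj₁ Z≐EM) = begin
          suc (N.ρ F + ρ K)            ≤⟨ vs-full ⟩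
          ρ EM                         ≡⟨ sym (ρ-≐ Z≐EM) ⟩
          ρ Z                          ≤⟨ m≤m+n (ρ Z) _ ⟩
          ρ Z + size ((F ∪ₛ K) ∖ Z)    ∎
      ... | inj₂ (inj₂ (inj₁ (F' , F'∈Z' , Z≐F'∪P))) = begin
          suc (N.ρ F + ρ K)                                 ≤⟨ vs-lift F' F'∈Z' mismatch ⟩
          (N.ρ F' + size P) + size ((F ∪ₛ K) ∖ (F' ∪ₛ P))   ≡⟨ cong₂ _+_ (sym (trans (ρ-≐ Z≐F'∪P) (lift-rank F' F'∈Z')))
                                                                       (sym (count-≐ (ground M) (∖-congʳ (F ∪ₛ K) Z≐F'∪P))) ⟩
          ρ Z + size ((F ∪ₛ K) ∖ Z)                         ∎
      ... | inj₂ (inj₂ (inj₂ other)) = vs-other Z (other-meets-S Z other) differs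

      -- hence F ∪ K lies above no cyclic flat, contradicting the rank formula
      impossible : ∀ {x} → Mismatch x → ¬ NF.Differs F S
      impossible mismatch differs with cyclic-flat-below (F ∪ₛ K) (∪-⊆ (λ z p → EN⊆EM z (F⊆EN z p)) K⊆EM)
      ... | Z , Z-cf , below = 1+n≰n (begin
          suc (N.ρ F + ρ K)            ≤⟨ vs-any mismatch differs Z Z-cf ⟩
          ρ Z + size ((F ∪ₛ K) ∖ Z)    ≤⟨ below ⟩
          ρ (F ∪ₛ K)                   ≡⟨ ρ-F∪K ⟩
          N.ρ F + ρ K                  ∎)

    -- such an F exists, so K and P agree everywhere
    no-mismatch : ¬ Uniform eq N → ¬ Z'IsSingleton eq N S → ∀ {x} → ¬ Mismatch x
    no-mismatch non-uniform not-only-S m =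
      NF.some-Z'-differs S⊆EN non-uniform not-only-S (λ F F∈Z' → Against.impossible F F∈Z' m)

    K≐P : ¬ Uniform eq N → ¬ Z'IsSingleton eq N S → K ≐ P
    K≐P non-uniform not-only-S x with K x in Kx | P x in Px
    ... | true | true = refl
    ... | false | false = refl
    ... | true | false = ⊥-elim (no-mismatch non-uniform not-only-S (inj₁ (Kx , Px)))
    ... | false | true = ⊥-elim (no-mismatch non-uniform not-only-S (inj₂ (Px , Kx)))

module _ {A : Set} (eq : DecidableEquality A) where

  -- the rank relation of a minor without truncated subtraction
  minor-rank : ∀ (M N : Matroid A) (C : Sub A)
             → (∀ X → rk N X ≡ rk M ((X ∩ₛ E eq N) ∪ₛ C) ∸ rk M C)
             → ∀ X → rk N X + rk M C ≡ rk M ((X ∩ₛ E eq N) ∪ₛ C)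
  minor-rank M N C rel X = trans (cong (_+ rk M C) (rel X)) (m∸n+n≡m (rk-mono M _ _ (⊆-∪ʳ (X ∩ₛ E eq N) C)))

  minor-compose : ∀ (M N N₁ : Matroid A) (C C₁ : Sub A)
                → (∀ X → rk N X ≡ rk M ((X ∩ₛ E eq N) ∪ₛ C) ∸ rk M C)
                → C₁ ⊆ₛ E eq N → E eq N₁ ⊆ₛ E eq N
                → (∀ X → rk N₁ X ≡ rk N ((X ∩ₛ E eq N₁) ∪ₛ C₁) ∸ rk N C₁)
                → ∀ X → rk N₁ X + rk M (C ∪ₛ C₁) ≡ rk M ((X ∩ₛ E eq N₁) ∪ₛ (C ∪ₛ C₁))
  minor-compose M N N₁ C C₁ relN C₁⊆EN EN₁⊆EN relN₁ X = begin
      rk N₁ X + rk M (C ∪ₛ C₁)                ≡⟨ cong (rk N₁ X +_) ρ-C∪C₁ ⟩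
      rk N₁ X + (rk N C₁ + rk M C)            ≡⟨ sym (+-assoc (rk N₁ X) _ _) ⟩
      (rk N₁ X + rk N C₁) + rk M C            ≡⟨ cong (_+ rk M C) (minor-rank N N₁ C₁ relN₁ X) ⟩
      rk N Y + rk M C                         ≡⟨ minor-rank M N C relN Y ⟩
      rk M ((Y ∩ₛ E eq N) ∪ₛ C)               ≡⟨ rk-ext M _ _ (λ x _ → regroup x) ⟩
      rk M ((X ∩ₛ E eq N₁) ∪ₛ (C ∪ₛ C₁))      ∎
    where
    open ≡-Reasoning
    Y : Sub A
    Y = (X ∩ₛ E eq N₁) ∪ₛ C₁
    Y⊆EN : Y ⊆ₛ E eq N
    Y⊆EN = ∪-⊆ (λ x p → EN₁⊆EN x (∧-conicalʳ (X x) _ p)) C₁⊆EN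
    C∪C₁ : ∀ x → (C ∪ₛ C₁) x ≡ ((C₁ ∩ₛ E eq N) ∪ₛ C) x
    C∪C₁ x = trans (∨-comm (C x) (C₁ x)) (cong (_∨ C x) (sym (∩-absorb C₁⊆EN x)))
    ρ-C∪C₁ : rk M (C ∪ₛ C₁) ≡ rk N C₁ + rk M C
    ρ-C∪C₁ = trans (rk-ext M _ _ (λ x _ → C∪C₁ x)) (sym (minor-rank M N C relN C₁))
    regroup : ∀ x → ((Y ∩ₛ E eq N) ∪ₛ C) x ≡ ((X ∩ₛ E eq N₁) ∪ₛ (C ∪ₛ C₁)) x
    regroup x = begin
      (Y ∩ₛ E eq N) x ∨ C x                        ≡⟨ cong (_∨ C x) (∩-absorb Y⊆EN x) ⟩
      ((X ∩ₛ E eq N₁) x ∨ C₁ x) ∨ C x              ≡⟨ ∨-assoc ((X ∩ₛ E eq N₁) x) (C₁ x) (C x) ⟩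
      (X ∩ₛ E eq N₁) x ∨ (C₁ x ∨ C x)              ≡⟨ cong ((X ∩ₛ E eq N₁) x ∨_) (∨-comm (C₁ x) (C x)) ⟩
      (X ∩ₛ E eq N₁) x ∨ (C x ∨ C₁ x)              ∎

-- The hypotheses of the theorem about M = M_k(N₁, A₁, U₁; N₂, A₂, U₂),
-- bundled so that the roles of the two sides can be exchanged.

record MkData {A : Set} (eq : DecidableEquality A) (M N₁ N₂ : Matroid A) (A₁ A₂ : Sub A) (k : ℕ)
              (U₁ U₂ : List A) : Set where
  field
    E₁∩E₂     : ∀ x → E eq N₁ x ≡ true → E eq N₂ x ≡ false
    A₁⊆E₁     : A₁ ⊆ₛ E eq N₁
    A₂⊆E₂     : A₂ ⊆ₛ E eq N₂
    k-large   : r eq N₁ + η eq N₁ A₁ + r eq N₂ + η eq N₂ A₂ ≤ k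
    U₁-unique : Unique U₁
    U₂-unique : Unique U₂
    |U₁|      : length U₁ ≡ k ∸ r eq N₁ ∸ card eq N₂ A₂
    |U₂|      : length U₂ ≡ k ∸ r eq N₂ ∸ card eq N₁ A₁
    U₁∩U₂     : ∀ x → mem eq U₁ x ≡ true → mem eq U₂ x ≡ false
    U₁-new    : ∀ x → mem eq U₁ x ≡ true → (E eq N₁ ∪ₛ E eq N₂) x ≡ false
    U₂-new    : ∀ x → mem eq U₂ x ≡ true → (E eq N₁ ∪ₛ E eq N₂) x ≡ false
    is-Mk     : IsMk eq M k N₁ A₁ U₁ N₂ A₂ U₂

IsMk-swap : ∀ {A} {eq : DecidableEquality A} {M k N₁ A₁ U₁ N₂ A₂ U₂}
          → IsMk eq M k N₁ A₁ U₁ N₂ A₂ U₂ → IsMk eq M k N₂ A₂ U₂ N₁ A₁ U₁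
IsMk-swap {eq = eq} {M} {k} {N₁} {A₁} {U₁} {N₂} {A₂} {U₂} (ground-split , cyclic-flats , ρ∅ , rM , lift₁ , lift₂) =
  ground-split' , cyclic-flats' , ρ∅ , rM , lift₂ , lift₁
  where
  ground-split' : E eq M ≐ (E eq N₂ ∪ₛ E eq N₁ ∪ₛ mem eq U₂ ∪ₛ mem eq U₁)
  ground-split' x = trans (ground-split x) (swap-parts (E eq N₁ x) (E eq N₂ x) (mem eq U₁ x) (mem eq U₂ x))
    where swap-parts : ∀ a b c d → a ∨ b ∨ c ∨ d ≡ b ∨ a ∨ d ∨ c
          swap-parts a b c d rewrite sym (∨-assoc a b (c ∨ d)) | ∨-comm a b | ∨-comm c d = ∨-assoc b a (d ∨ c)
  swap-lifts : ∀ {P Q R S : Set} → P ⊎ Q ⊎ R ⊎ S → P ⊎ Q ⊎ S ⊎ R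
  swap-lifts (inj₁ p) = inj₁ p
  swap-lifts (inj₂ (inj₁ q)) = inj₂ (inj₁ q)
  swap-lifts (inj₂ (inj₂ (inj₁ r))) = inj₂ (inj₂ (inj₂ r))
  swap-lifts (inj₂ (inj₂ (inj₂ s))) = inj₂ (inj₂ (inj₁ s))
  cyclic-flats' : ∀ Z → CyclicFlat eq M Z ⇔
    ((Z ≐ ∅ₛ) ⊎ (Z ≐ E eq M) ⊎ (∃ λ F → Z' eq N₂ F × (Z ≐ F ∪ₛ mem eq U₂ ∪ₛ A₁))
                              ⊎ (∃ λ F → Z' eq N₁ F × (Z ≐ F ∪ₛ mem eq U₁ ∪ₛ A₂)))
  cyclic-flats' Z = mk⇔ (λ cf → swap-lifts (Equivalence.to (cyclic-flats Z) cf))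
                        (λ cases → Equivalence.from (cyclic-flats Z) (swap-lifts cases))

swap : ∀ {A} {eq : DecidableEquality A} {M N₁ N₂ A₁ A₂ k U₁ U₂}
     → MkData eq M N₁ N₂ A₁ A₂ k U₁ U₂ → MkData eq M N₂ N₁ A₂ A₁ k U₂ U₁
swap {eq = eq} {M} {N₁} {N₂} {A₁} {A₂} {k} {U₁} {U₂} d = record
  { E₁∩E₂ = disjoint-sym E₁∩E₂
  ; A₁⊆E₁ = A₂⊆E₂
  ; A₂⊆E₂ = A₁⊆E₁
  ; k-large = ≤-trans (≤-reflexive (swap-pairs (r eq N₂) _ (r eq N₁) _)) k-large
  ; U₁-unique = U₂-unique
  ; U₂-unique = U₁-unique
  ; |U₁| = |U₂|
  ; |U₂| = |U₁|
  ; U₁∩U₂ = disjoint-sym U₁∩U₂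
  ; U₁-new = λ x x∈U₂ → trans (∨-comm (E eq N₂ x) _) (U₂-new x x∈U₂)
  ; U₂-new = λ x x∈U₁ → trans (∨-comm (E eq N₂ x) _) (U₁-new x x∈U₁)
  ; is-Mk = IsMk-swap {M = M} {k} {N₁} {A₁} {U₁} {N₂} {A₂} {U₂} is-Mk
  }
  where
  open MkData d
  swap-pairs : ∀ a b c d → a + b + c + d ≡ c + d + a + b
  swap-pairs = solve-∀

gap-filled : ∀ a c k → a + c ≤ k → a + ((k ∸ a ∸ c) + c) ≡ k
gap-filled a c k a+c≤k = trans (cong (a +_) (m∸n+n≡m c≤k∸a)) (m+[n∸m]≡n (≤-trans (m≤m+n a c) a+c≤k))
  where c≤k∸a : c ≤ k ∸ a
        c≤k∸a = m+n≤o⇒m≤o∸n c (≤-trans (≤-reflexive (+-comm c a)) a+c≤k)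

module FirstSide {A : Set} {eq : DecidableEquality A} {M N₁ N₂ A₁ A₂ k U₁ U₂}
                 (d : MkData eq M N₁ N₂ A₁ A₂ k U₁ U₂) where

  open MkData d
  open RankCalculus eq M
  module R₁ = RankCalculus eq N₁
  module R₂ = RankCalculus eq N₂
  open ≤-Reasoning

  E₁ E₂ : Sub A
  E₁ = E eq N₁
  E₂ = E eq N₂

  r₁ r₂ c₁ c₂ η₁ η₂ : ℕ
  r₁ = r eq N₁
  r₂ = r eq N₂
  c₁ = card eq N₁ A₁
  c₂ = card eq N₂ A₂
  η₁ = η eq N₁ A₁
  η₂ = η eq N₂ A₂

  P₁ : Sub A
  P₁ = mem eq U₁ ∪ₛ A₂

  Lift₂ : Sub A → Set
  Lift₂ Z = ∃ λ F → Z' eq N₂ F × (Z ≐ F ∪ₛ mem eq U₂ ∪ₛ A₁)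

  ground-split : EM ≐ (E₁ ∪ₛ E₂ ∪ₛ mem eq U₁ ∪ₛ mem eq U₂)
  ground-split = proj₁ is-Mk

  in-ground : ∀ {X} → X ⊆ₛ (E₁ ∪ₛ E₂ ∪ₛ mem eq U₁ ∪ₛ mem eq U₂) → X ⊆ₛ EM
  in-ground X⊆ x p = trans (ground-split x) (X⊆ x p)

  E₁⊆EM : E₁ ⊆ₛ EM
  E₁⊆EM = in-ground (⊆-∪ˡ E₁ (E₂ ∪ₛ mem eq U₁ ∪ₛ mem eq U₂))

  E₂⊆EM : E₂ ⊆ₛ EM
  E₂⊆EM = in-ground (λ x p → ⊆-∪ʳ E₁ (E₂ ∪ₛ mem eq U₁ ∪ₛ mem eq U₂) x
                                 (⊆-∪ˡ E₂ (mem eq U₁ ∪ₛ mem eq U₂) x p))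

  U₁⊆EM : mem eq U₁ ⊆ₛ EM
  U₁⊆EM = in-ground (λ x p → ⊆-∪ʳ E₁ (E₂ ∪ₛ mem eq U₁ ∪ₛ mem eq U₂) x
                                 (⊆-∪ʳ E₂ (mem eq U₁ ∪ₛ mem eq U₂) x (⊆-∪ˡ (mem eq U₁) (mem eq U₂) x p)))

  P₁⊆EM : P₁ ⊆ₛ EM
  P₁⊆EM = ∪-⊆ U₁⊆EM (λ x p → E₂⊆EM x (A₂⊆E₂ x p))

  U₁∩E₂ : ∀ x → mem eq U₁ x ≡ true → E₂ x ≡ false
  U₁∩E₂ x p = ∨-conicalʳ (E₁ x) _ (U₁-new x p)

  U₁∩E₁ : ∀ x → mem eq U₁ x ≡ true → E₁ x ≡ false
  U₁∩E₁ x p = ∨-conicalˡ (E₁ x) _ (U₁-new x p)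

  P₁∩E₁ : ∀ x → P₁ x ≡ true → E₁ x ≡ false
  P₁∩E₁ x p with ∪-elim (mem eq U₁) {A₂} p
  ... | inj₁ x∈U₁ = U₁∩E₁ x x∈U₁
  ... | inj₂ x∈A₂ = disjoint-sym E₁∩E₂ x (A₂⊆E₂ x x∈A₂)

  size-split : ∀ (N : Matroid A) X → rk N X + η eq N X ≡ card eq N X
  size-split N X = m+[n∸m]≡n (rk-card N X)

  r₁+c₂≤k : r₁ + c₂ ≤ k
  r₁+c₂≤k = begin
      r₁ + c₂                  ≡⟨ cong (r₁ +_) (sym (size-split N₂ A₂)) ⟩
      r₁ + (R₂.ρ A₂ + η₂)      ≤⟨ +-mono-≤ (m≤m+n r₁ η₁) (+-monoˡ-≤ η₂ (R₂.ρ-mono A₂⊆E₂)) ⟩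
      (r₁ + η₁) + (r₂ + η₂)    ≡⟨ sym (+-assoc (r₁ + η₁) r₂ η₂) ⟩
      r₁ + η₁ + r₂ + η₂        ≤⟨ k-large ⟩
      k                        ∎

  r₂+c₁≤k : r₂ + c₁ ≤ k
  r₂+c₁≤k = begin
      r₂ + c₁                  ≡⟨ cong (r₂ +_) (sym (size-split N₁ A₁)) ⟩
      r₂ + (R₁.ρ A₁ + η₁)      ≤⟨ +-mono-≤ (m≤m+n r₂ η₂) (+-monoˡ-≤ η₁ (R₁.ρ-mono A₁⊆E₁)) ⟩
      (r₂ + η₂) + (r₁ + η₁)    ≡⟨ exchange r₂ η₂ r₁ η₁ ⟩
      r₁ + η₁ + r₂ + η₂        ≤⟨ k-large ⟩
      k                        ∎
    where exchange : ∀ a b c d → (a + b) + (c + d) ≡ c + d + a + b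
          exchange = solve-∀

  size-of-E₂-subset : ∀ X → X ⊆ₛ E₂ → size X ≡ R₂.size X
  size-of-E₂-subset X X⊆E₂ = count-sublist eq X (ground N₂) (ground M) (ground-unique N₂) (ground-unique M) X⊆E₂
    (λ x x∈ → mem-∈ eq (ground M) (E₂⊆EM x (∈-mem eq x∈)))

  size-P₁ : size P₁ ≡ length U₁ + c₂
  size-P₁ = trans (count-union (mem eq U₁) A₂ (ground M) U₁∩A₂)
                  (cong₂ _+_ (count-list eq U₁ (ground M) U₁-unique (ground-unique M)
                                (λ x x∈U₁ → mem-∈ eq (ground M) (U₁⊆EM x (∈-mem eq x∈U₁))))
                             (size-of-E₂-subset A₂ A₂⊆E₂))
    where
    U₁∩A₂ : ∀ x → mem eq U₁ x ≡ true → A₂ x ≡ false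
    U₁∩A₂ x p = ⊆-false x A₂⊆E₂ (U₁∩E₂ x p)

  r₁+|P₁|≡k : r₁ + size P₁ ≡ k
  r₁+|P₁|≡k = trans (cong (r₁ +_) (trans size-P₁ (cong (_+ c₂) |U₁|))) (gap-filled r₁ c₂ k r₁+c₂≤k)

  lift-rank₁ : ∀ F → Z' eq N₁ F → ρ (F ∪ₛ P₁) ≡ R₁.ρ F + size P₁
  lift-rank₁ F F∈Z' = trans (proj₁ (proj₂ (proj₂ (proj₂ (proj₂ is-Mk)))) F F∈Z')
                            (trans (+-assoc (R₁.ρ F) _ _) (cong (R₁.ρ F +_) (sym size-P₁)))

  U₂∩E₁ : ∀ x → E₁ x ≡ true → mem eq U₂ x ≡ false
  U₂∩E₁ = disjoint-sym (λ x p → ∨-conicalˡ (E₁ x) _ (U₂-new x p))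

  U₂∩E₂ : ∀ x → E₂ x ≡ true → mem eq U₂ x ≡ false
  U₂∩E₂ = disjoint-sym (λ x p → ∨-conicalʳ (E₁ x) _ (U₂-new x p))

  other-meets-A₁ : ∀ Z → Lift₂ Z → ∀ x → E₁ x ≡ true → Z x ≡ A₁ x
  other-meets-A₁ Z (F , F∈Z' , Z≐) x x∈E₁
    rewrite Z≐ x | ⊆-false x (proj₁ (proj₁ (proj₁ F∈Z'))) (E₁∩E₂ x x∈E₁) | U₂∩E₁ x x∈E₁ = refl

  r₁+η₂≤|U₂|+c₁ : r₁ + η₂ ≤ length U₂ + c₁
  r₁+η₂≤|U₂|+c₁ = +-cancelʳ-≤ r₂ _ _ (begin
      (r₁ + η₂) + r₂           ≤⟨ +-monoˡ-≤ r₂ (+-monoˡ-≤ η₂ (m≤m+n r₁ η₁)) ⟩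
      (r₁ + η₁ + η₂) + r₂      ≡⟨ exchange r₁ η₁ η₂ r₂ ⟩
      r₁ + η₁ + r₂ + η₂        ≤⟨ k-large ⟩
      k                        ≡⟨ sym (gap-filled r₂ c₁ k r₂+c₁≤k) ⟩
      r₂ + ((k ∸ r₂ ∸ c₁) + c₁) ≡⟨ cong (λ n → r₂ + (n + c₁)) (sym |U₂|) ⟩
      r₂ + (length U₂ + c₁)    ≡⟨ +-comm r₂ _ ⟩
      (length U₂ + c₁) + r₂    ∎)
    where exchange : ∀ a b c d → (a + b + c) + d ≡ a + b + d + c
          exchange = solve-∀

  -- a cyclic flat lifted from N₂ is large enough not to disturb the contraction of P₁
  other-rank₁ : ∀ Z → Lift₂ Z → r₁ + size P₁ ≤ ρ Z + size (P₁ ∖ Z)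
  other-rank₁ Z (F , F∈Z' , Z≐) = begin
      r₁ + size P₁                                      ≡⟨ cong (r₁ +_) (trans size-P₁ (cong (length U₁ +_) c₂-split)) ⟩
      r₁ + (length U₁ + (R₂.ρ A₂ + η₂))                 ≤⟨ +-monoʳ-≤ r₁ (+-monoʳ-≤ (length U₁) A₂-excess) ⟩
      r₁ + (length U₁ + ((R₂.ρ F + a₂) + η₂))           ≡⟨ regroup r₁ (length U₁) (R₂.ρ F) a₂ η₂ ⟩
      (R₂.ρ F + (r₁ + η₂)) + (length U₁ + a₂)           ≤⟨ +-monoˡ-≤ _ (+-monoʳ-≤ (R₂.ρ F) r₁+η₂≤|U₂|+c₁) ⟩
      (R₂.ρ F + (length U₂ + c₁)) + (length U₁ + a₂)    ≡⟨ cong₂ _+_ (sym ρZ) (sym size-parts) ⟩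
      ρ Z + size (mem eq U₁ ∪ₛ (A₂ ∖ F))                ≤⟨ +-monoʳ-≤ (ρ Z) (count-mono (ground M) parts⊆) ⟩
      ρ Z + size (P₁ ∖ Z)                               ∎
    where
    regroup : ∀ a u f b e → a + (u + ((f + b) + e)) ≡ (f + (a + e)) + (u + b)
    regroup = solve-∀
    F⊆E₂ : F ⊆ₛ E₂
    F⊆E₂ = proj₁ (proj₁ (proj₁ F∈Z'))
    a₂ : ℕ
    a₂ = R₂.size (A₂ ∖ F)
    c₂-split : c₂ ≡ R₂.ρ A₂ + η₂
    c₂-split = sym (size-split N₂ A₂)
    A₂-excess : R₂.ρ A₂ + η₂ ≤ (R₂.ρ F + a₂) + η₂
    A₂-excess = +-monoˡ-≤ η₂ (R₂.ρ-excess A₂ F)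
    ρZ : ρ Z ≡ R₂.ρ F + (length U₂ + c₁)
    ρZ = trans (ρ-≐ Z≐) (trans (proj₂ (proj₂ (proj₂ (proj₂ (proj₂ is-Mk)))) F F∈Z') (+-assoc (R₂.ρ F) _ _))
    U₁∩A₂∖F : ∀ x → mem eq U₁ x ≡ true → (A₂ ∖ F) x ≡ false
    U₁∩A₂∖F x p = ⊆-false x (λ z q → A₂⊆E₂ z (∖-⊆ A₂ F z q)) (U₁∩E₂ x p)
    size-parts : size (mem eq U₁ ∪ₛ (A₂ ∖ F)) ≡ length U₁ + a₂
    size-parts = trans (count-union (mem eq U₁) (A₂ ∖ F) (ground M) U₁∩A₂∖F)
      (cong₂ _+_ (count-list eq U₁ (ground M) U₁-unique (ground-unique M)
                   (λ x x∈U₁ → mem-∈ eq (ground M) (U₁⊆EM x (∈-mem eq x∈U₁))))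
                 (size-of-E₂-subset (A₂ ∖ F) (λ z q → A₂⊆E₂ z (∖-⊆ A₂ F z q))))
    parts⊆ : (mem eq U₁ ∪ₛ (A₂ ∖ F)) ⊆ₛ (P₁ ∖ Z)
    parts⊆ x p with ∪-elim (mem eq U₁) {A₂ ∖ F} p
    ... | inj₁ x∈U₁ = ∈-∖ P₁ Z (⊆-∪ˡ (mem eq U₁) A₂ x x∈U₁) (trans (Z≐ x)
          (∉-∪ F (mem eq U₂ ∪ₛ A₁) (⊆-false x F⊆E₂ (U₁∩E₂ x x∈U₁))
                   (∉-∪ (mem eq U₂) A₁ (U₁∩U₂ x x∈U₁) (⊆-false x A₁⊆E₁ (U₁∩E₁ x x∈U₁)))))
    ... | inj₂ x∈A₂∖F = ∈-∖ P₁ Z (⊆-∪ʳ (mem eq U₁) A₂ x (∖-⊆ A₂ F x x∈A₂∖F)) (trans (Z≐ x)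
          (∉-∪ F (mem eq U₂ ∪ₛ A₁) (not-true (∧-conicalʳ (A₂ x) _ x∈A₂∖F))
                   (∉-∪ (mem eq U₂) A₁ (U₂∩E₂ x x∈E₂) (⊆-false x A₁⊆E₁ (disjoint-sym E₁∩E₂ x x∈E₂)))))
      where x∈E₂ : E₂ x ≡ true
            x∈E₂ = A₂⊆E₂ x (∖-⊆ A₂ F x x∈A₂∖F)

  cyclic-flats₁ : ∀ Z → CyclicFlat eq M Z
                → (Z ≐ ∅ₛ) ⊎ (Z ≐ EM) ⊎ (∃ λ F → Z' eq N₁ F × Z ≐ (F ∪ₛ P₁)) ⊎ Lift₂ Z
  cyclic-flats₁ Z = Equivalence.to (proj₁ (proj₂ is-Mk) Z)

  open Contraction eq M N₁ A₁ P₁ k Lift₂ E₁⊆EM P₁⊆EM P₁∩E₁ A₁⊆E₁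
         (proj₁ (proj₂ (proj₂ (proj₂ is-Mk)))) r₁+|P₁|≡k cyclic-flats₁ lift-rank₁ other-meets-A₁ other-rank₁
    public using (is-minor; module Uniqueness)

module _ {A : Set} {eq : DecidableEquality A} {M N₁ N₂ A₁ A₂ k U₁ U₂}
         (d : MkData eq M N₁ N₂ A₁ A₂ k U₁ U₂) where

  private
    module Side₁ = FirstSide d

  composite-contraction : ¬ Uniform eq N₁ → ¬ Z'IsSingleton eq N₁ A₁
    → ∀ N (C : Sub A) → C ⊆ₛ E eq M → E eq N ⊆ₛ E eq M → (∀ x → x ∈ₛ E eq N → C x ≡ false)
    → (∀ X → rk N X ≡ rk M ((X ∩ₛ E eq N) ∪ₛ C) ∸ rk M C)
    → IsMinor eq N₁ N → Σ (Sub A) λ C₁ → C₁ ⊆ₛ E eq N × E eq N₁ ⊆ₛ E eq N × (C ∪ₛ C₁) ≐ Side₁.P₁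
  composite-contraction non-uniform not-only-A₁ N C C⊆EM EN⊆EM C∩EN relN (C₁ , C₁⊆EN , E₁⊆EN , C₁∩E₁ , rel₁) =
    C₁ , C₁⊆EN , E₁⊆EN ,
    Side₁.Uniqueness.K≐P (C ∪ₛ C₁) (∪-⊆ C⊆EM (λ z p → EN⊆EM z (C₁⊆EN z p)))
      (λ z z∈E₁ → ∉-∪ C C₁ (C∩EN z (E₁⊆EN z z∈E₁)) (C₁∩E₁ z z∈E₁))
      (minor-compose eq M N N₁ C C₁ relN C₁⊆EN E₁⊆EN rel₁) non-uniform not-only-A₁

module _ {A : Set} {eq : DecidableEquality A} {M N₁ N₂ A₁ A₂ k U₁ U₂}
         (d : MkData eq M N₁ N₂ A₁ A₂ k U₁ U₂) where

  open MkData d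
  private
    module Side₁ = FirstSide d
    module Side₂ = FirstSide (swap d)

  contracted-sets-disjoint : ∀ x → Side₁.P₁ x ≡ true → Side₂.P₁ x ≡ false
  contracted-sets-disjoint x p with ∪-elim (mem eq U₁) {A₂} p
  ... | inj₁ x∈U₁ = ∉-∪ (mem eq U₂) A₁ (U₁∩U₂ x x∈U₁) (⊆-false x A₁⊆E₁ (Side₁.U₁∩E₁ x x∈U₁))
  ... | inj₂ x∈A₂ = ∉-∪ (mem eq U₂) A₁ (Side₁.U₂∩E₂ x (A₂⊆E₂ x x∈A₂))
                                      (⊆-false x A₁⊆E₁ (disjoint-sym E₁∩E₂ x (A₂⊆E₂ x x∈A₂)))

  uncovered-outside : ∀ x → E eq N₁ x ≡ false → E eq N₂ x ≡ false
                    → Side₁.P₁ x ≡ false → Side₂.P₁ x ≡ false → E eq M x ≡ false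
  uncovered-outside x x∉E₁ x∉E₂ x∉P₁ x∉P₂ = trans (Side₁.ground-split x)
    (∉-∪ (E eq N₁) (E eq N₂ ∪ₛ mem eq U₁ ∪ₛ mem eq U₂) x∉E₁
      (∉-∪ (E eq N₂) (mem eq U₁ ∪ₛ mem eq U₂) x∉E₂
        (∉-∪ (mem eq U₁) (mem eq U₂) (∨-conicalˡ (mem eq U₁ x) _ x∉P₁) (∨-conicalˡ (mem eq U₂ x) _ x∉P₂))))

  intertwine : ¬ Uniform eq N₁ → ¬ Uniform eq N₂ → ¬ Z'IsSingleton eq N₁ A₁ → ¬ Z'IsSingleton eq N₂ A₂
             → LabelledIntertwine eq M N₁ N₂
  intertwine nu₁ nu₂ ns₁ ns₂ = Side₁.is-minor , Side₂.is-minor , no-common-proper-minor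
    where
    no-common-proper-minor : ∀ N → IsProperMinor eq N M → ¬ (IsMinor eq N₁ N × IsMinor eq N₂ N)
    no-common-proper-minor N ((C , C⊆EM , EN⊆EM , C∩EN , relN) , (x , x∈EM , x∉EN)) (minor₁ , minor₂)
      with composite-contraction d nu₁ ns₁ N C C⊆EM EN⊆EM C∩EN relN minor₁
         | composite-contraction (swap d) nu₂ ns₂ N C C⊆EM EN⊆EM C∩EN relN minor₂
    ... | C₁ , C₁⊆EN , E₁⊆EN , K₁≐P₁ | C₂ , C₂⊆EN , E₂⊆EN , K₂≐P₂ = by-cases (C x) refl
      where
      by-cases : ∀ b → C x ≡ b → ⊥
      by-cases true Cx = bool-clash (trans (sym (K₂≐P₂ x)) (⊆-∪ˡ C C₂ x Cx))
        (contracted-sets-disjoint x (trans (sym (K₁≐P₁ x)) (⊆-∪ˡ C C₁ x Cx)))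
      by-cases false Cx = bool-clash x∈EM (uncovered-outside x
        (⊆-false x E₁⊆EN x∉EN) (⊆-false x E₂⊆EN x∉EN)
        (trans (sym (K₁≐P₁ x)) (∉-∪ C C₁ Cx (⊆-false x C₁⊆EN x∉EN)))
        (trans (sym (K₂≐P₂ x)) (∉-∪ C C₂ Cx (⊆-false x C₂⊆EN x∉EN))))

-- Theorem 3.6
theorem3p6 : {A : Set} (eq : DecidableEquality A)
    (M₁ M₂ : Matroid A) (S₁' S₂' : Sub A) (k : ℕ) (T₁ T₂ : List A) (M : Matroid A)
    → 0 < r eq M₁ → 0 < r eq M₂
    → (∀ x → E eq M₁ x ≡ true → E eq M₂ x ≡ false)
    → S₁' ⊆ₛ E eq M₁ → S₂' ⊆ₛ E eq M₂
    → r eq M₁ + η eq M₁ S₁' + r eq M₂ + η eq M₂ S₂' ≤ k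
    → Unique T₁ → Unique T₂
    → length T₁ ≡ k ∸ r eq M₁ ∸ card eq M₂ S₂'
    → length T₂ ≡ k ∸ r eq M₂ ∸ card eq M₁ S₁'
    → (∀ x → mem eq T₁ x ≡ true → mem eq T₂ x ≡ false)
    → (∀ x → mem eq T₁ x ≡ true → (E eq M₁ ∪ₛ E eq M₂) x ≡ false)
    → (∀ x → mem eq T₂ x ≡ true → (E eq M₁ ∪ₛ E eq M₂) x ≡ false)
    → ¬ Uniform eq M₁ → ¬ Uniform eq M₂
    → ¬ Z'IsSingleton eq M₁ S₁' → ¬ Z'IsSingleton eq M₂ S₂'
    → IsMk eq M k M₁ S₁' T₁ M₂ S₂' T₂
    → LabelledIntertwine eq M M₁ M₂
theorem3p6 eq M₁ M₂ S₁' S₂' k T₁ T₂ M _ _ disjoint S₁'⊆E₁ S₂'⊆E₂ k-large T₁-unique T₂-unique |T₁| |T₂|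
           T₁∩T₂ T₁-new T₂-new non-uniform₁ non-uniform₂ not-only-S₁' not-only-S₂' is-Mk =
  intertwine mk-data non-uniform₁ non-uniform₂ not-only-S₁' not-only-S₂'
  where
  mk-data : MkData eq M M₁ M₂ S₁' S₂' k T₁ T₂
  mk-data = record
    { E₁∩E₂ = disjoint ; A₁⊆E₁ = S₁'⊆E₁ ; A₂⊆E₂ = S₂'⊆E₂ ; k-large = k-large
    ; U₁-unique = T₁-unique ; U₂-unique = T₂-unique ; |U₁| = |T₁| ; |U₂| = |T₂|
    ; U₁∩U₂ = T₁∩T₂ ; U₁-new = T₁-new ; U₂-new = T₂-new ; is-Mk = is-Mk
    }
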